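{- Let $R$ be a commutative ring with identity and let $F\in R[[X,Y]]$ satisfy $F(0,0)=0$. For $f,g\in \tau R[[\tau]]$ put $f\oplus_F g=F(f,g)$ (which is again an element of $\tau R[[\tau]]$). The following are equivalent: (1) $F(X,0)=X$, $F(X,Y)=F(Y,X)$, and $F(F(X,Y),Z)=F(X,F(Y,Z))$ in $R[[X,Y,Z]]$; (2) the operation $\oplus_F$ makes $\tau R[[\tau]]$ into an abelian group with identity $0$; (3) the operation $\oplus_F$ makes $\tau R[[\tau]]$ into an abelian (commutative) semigroup with identity $0$.
   Context: $R[[\tau]]$ denotes formal power series in one variable $\tau$ over $R$ and $\tau R[[\tau]]$ those with zero constant term; substituting elements of $\tau R[[\tau]]$ into a two-variable power series is well defined. -}

module Defs where

open import Level using (_⊔_)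
open import Data.Nat using (ℕ; zero; suc; _∸_)
open import Data.Fin using (Fin; zero; suc)
open import Data.Vec using (Vec; []; _∷_; zipWith; replicate; sum)
open import Data.Product using (Σ; _,_; proj₁; proj₂)
open import Relation.Binary using (Rel)
open import Algebra.Bundles using (CommutativeRing)
open import Algebra.Structures using (IsAbelianGroup; IsCommutativeMonoid)
open import Data.Product using (_×_)

module PowerSeries {c ℓ} (R : CommutativeRing c ℓ) where
  open CommutativeRing R public hiding (zero)

  Series : ℕ → Set c
  Series k = Vec ℕ k → Carrier

  _≋_ : ∀ {k} → Rel (Series k) ℓ
  f ≋ g = ∀ e → f e ≈ g e

  sumTo : ℕ → (ℕ → Carrier) → Carrier
  sumTo zero h = h zero
  sumTo (suc n) h = sumTo n h + h (suc n)

  sumBox : ∀ {k} → Vec ℕ k → (Vec ℕ k → Carrier) → Carrier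
  sumBox [] h = h []
  sumBox (n ∷ e) h = sumTo n (λ i → sumBox e (λ d → h (i ∷ d)))

  𝟘 : ∀ {k} → Series k
  𝟘 _ = 0#

  𝟙 : ∀ {k} → Series k
  𝟙 [] = 1#
  𝟙 (zero ∷ e) = 𝟙 e
  𝟙 (suc _ ∷ e) = 0#

  var : ∀ {k} → Fin k → Series k
  var zero (zero ∷ e) = 0#
  var zero (suc zero ∷ e) = 𝟙 e
  var zero (suc (suc _) ∷ e) = 0#
  var (suc i) (zero ∷ e) = var i e
  var (suc i) (suc _ ∷ e) = 0#

  _⋆_ : ∀ {k} → Series k → Series k → Series k
  (f ⋆ g) e = sumBox e (λ d → f d * g (zipWith _∸_ e d))

  _^ˢ_ : ∀ {k} → Series k → ℕ → Series k
  f ^ˢ zero = 𝟙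
  f ^ˢ suc n = f ⋆ (f ^ˢ n)

  const : ∀ {k} → Series k → Carrier
  const {k} f = f (replicate k 0)

  -- substitution F(f,g) of series f,g (with zero constant term) into
  -- a two-variable series F: the coefficient of a monomial of total
  -- degree N only involves terms F_{ij} f^i g^j with i,j ≤ N.
  subst : ∀ {k} → Series 2 → Series k → Series k → Series k
  subst F f g e =
    sumTo N (λ i → sumTo N (λ j → F (i ∷ j ∷ []) * ((f ^ˢ i) ⋆ (g ^ˢ j)) e))
    where N = sum e

  τSeries : Set (c ⊔ ℓ)
  τSeries = Σ (Series 1) (λ f → const f ≈ 0#)

  _≈τ_ : Rel τSeries ℓ
  f ≈τ g = proj₁ f ≋ proj₁ g

  0τ : τSeries
  0τ = 𝟘 , refl

  ⊕[_,_] : (F : Series 2) → F (0 ∷ 0 ∷ []) ≈ 0# → τSeries → τSeries → τSeries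
  ⊕[ F , F00 ] f g = subst F (proj₁ f) (proj₁ g) ,
    trans (*-congʳ F00) (zeroˡ _)

  τ : Series 1
  τ = var zero

  X' Y' : Series 2
  X' = var zero
  Y' = var (suc zero)

  X Y Z : Series 3
  X = var zero
  Y = var (suc zero)
  Z = var (suc (suc zero))

  Cond1 : Series 2 → Set ℓ
  Cond1 F = (subst F τ 𝟘 ≋ τ)
          × (subst F X' Y' ≋ subst F Y' X')
          × (subst F (subst F X Y) Z ≋ subst F X (subst F Y Z))

  Cond2 : (F : Series 2) → F (0 ∷ 0 ∷ []) ≈ 0# → Set (c ⊔ ℓ)
  Cond2 F F00 = Σ (τSeries → τSeries) (λ inv → IsAbelianGroup _≈τ_ ⊕[ F , F00 ] 0τ inv)

  Cond3 : (F : Series 2) → F (0 ∷ 0 ∷ []) ≈ 0# → Set (c ⊔ ℓ)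
  Cond3 F F00 = IsCommutativeMonoid _≈τ_ ⊕[ F , F00 ] 0τ

module Submission where

-- Substituting series of order ≥ 1 into power series is associative
-- (eval-eval), so the identities of (1) in R[[X,Y,Z]] specialise to the laws of
-- ⊕_F on τR[[τ]].  The inverse of f is ι(f), where ι solves F(τ, ι) = 0; it is
-- the limit of the iteration g ↦ g − F(τ, g), which fixes one more coefficient
-- at each step because F(X, Y) ≡ X + Y modulo degree 2.  Conversely, the laws of
-- (3) are pulled back from τR[[τ]] to R[[X,Y,Z]] by Kronecker substitution
-- X, Y, Z ↦ τ, τ^M, τ^Q: for M, Q large compared with a target exponent, only
-- that exponent and exponents already handled by induction contribute to the
-- corresponding coefficient of τ.

open import Data.Nat as ℕ using (ℕ; zero; suc; _∸_; _≤_; _<_; z≤n; s≤s)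
import Data.Nat.Properties as ℕ
open import Data.Nat.Induction using (<-rec)
open import Data.Nat.Tactic.RingSolver using (solve-∀)
open import Data.Fin using (Fin; zero; suc)
open import Data.Vec using (Vec; []; _∷_; zipWith; replicate; sum; map; lookup)
import Data.Vec.Properties as Vec
open import Data.Vec.Relation.Unary.All using (All; []; _∷_)
open import Data.Vec.Relation.Binary.Pointwise.Inductive using (Pointwise; []; _∷_)
open import Data.Product using (_×_; _,_; proj₁; proj₂)
open import Data.Sum using (_⊎_; inj₁; inj₂)
open import Data.Empty using (⊥; ⊥-elim)
open import Data.Unit using (⊤; tt)
open import Data.Maybe using (nothing)
open import Relation.Binary.PropositionalEquality as ≡ using (_≡_; _≢_)
open import Relation.Binary.Structures using (IsEquivalence)
open import Relation.Binary.Bundles using (Setoid)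
import Relation.Binary.Construct.On as On
import Relation.Binary.Reasoning.Setoid as SetoidReasoning
open import Relation.Nullary using (Dec; yes; no)
open import Algebra.Bundles using (CommutativeRing; CommutativeMonoid)
open import Algebra.Structures using (IsAbelianGroup; IsCommutativeMonoid)
open import Tactic.RingSolver.Core.AlmostCommutativeRing using (fromCommutativeRing)
open import Defs

module MultiIndex where

  infix 4 _≤ᵥ_
  infixl 6 _+ᵥ_ _-ᵥ_

  _≤ᵥ_ : ∀ {k} → Vec ℕ k → Vec ℕ k → Set
  [] ≤ᵥ [] = ⊤
  (a ∷ u) ≤ᵥ (b ∷ v) = a ≤ b × u ≤ᵥ v

  -- A constructive form of ¬ (u ≤ᵥ v).
  Exceeds : ∀ {k} → Vec ℕ k → Vec ℕ k → Set
  Exceeds [] [] = ⊥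
  Exceeds (a ∷ u) (b ∷ v) = b < a ⊎ Exceeds u v

  _+ᵥ_ _-ᵥ_ : ∀ {k} → Vec ℕ k → Vec ℕ k → Vec ℕ k
  u +ᵥ v = zipWith ℕ._+_ u v
  u -ᵥ v = zipWith _∸_ u v

  0ᵥ : ∀ {k} → Vec ℕ k
  0ᵥ = replicate _ 0

  ≤ᵥ-trans : ∀ {k} (u v w : Vec ℕ k) → u ≤ᵥ v → v ≤ᵥ w → u ≤ᵥ w
  ≤ᵥ-trans [] [] [] _ _ = tt
  ≤ᵥ-trans (a ∷ u) (b ∷ v) (c ∷ w) (p , q) (p' , q') = ℕ.≤-trans p p' , ≤ᵥ-trans u v w q q'

  _≤ᵥ?_ : ∀ {k} (u v : Vec ℕ k) → Dec (u ≤ᵥ v)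
  [] ≤ᵥ? [] = yes tt
  (a ∷ u) ≤ᵥ? (b ∷ v) with a ℕ.≤? b | u ≤ᵥ? v
  ... | yes p | yes q = yes (p , q)
  ... | no ¬p | _ = no (λ r → ¬p (proj₁ r))
  ... | yes _ | no ¬q = no (λ r → ¬q (proj₂ r))

  0ᵥ≤ᵥ : ∀ {k} (u : Vec ℕ k) → 0ᵥ ≤ᵥ u
  0ᵥ≤ᵥ [] = tt
  0ᵥ≤ᵥ (a ∷ u) = z≤n , 0ᵥ≤ᵥ u

  u-v≤ᵥu : ∀ {k} (u v : Vec ℕ k) → u -ᵥ v ≤ᵥ u
  u-v≤ᵥu [] [] = tt
  u-v≤ᵥu (a ∷ u) (b ∷ v) = ℕ.m∸n≤m a b , u-v≤ᵥu u v

  u≤ᵥu+v : ∀ {k} (u v : Vec ℕ k) → u ≤ᵥ u +ᵥ v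
  u≤ᵥu+v [] [] = tt
  u≤ᵥu+v (a ∷ u) (b ∷ v) = ℕ.m≤m+n a b , u≤ᵥu+v u v

  replicate-mono-≤ᵥ : ∀ k {m n} → m ≤ n → replicate k m ≤ᵥ replicate k n
  replicate-mono-≤ᵥ zero p = tt
  replicate-mono-≤ᵥ (suc k) p = p , replicate-mono-≤ᵥ k p

  u-0≡u : ∀ {k} (u : Vec ℕ k) → u -ᵥ 0ᵥ ≡ u
  u-0≡u [] = ≡.refl
  u-0≡u (a ∷ u) = ≡.cong (a ∷_) (u-0≡u u)

  u+[v-u]≡v : ∀ {k} (u v : Vec ℕ k) → u ≤ᵥ v → u +ᵥ (v -ᵥ u) ≡ v
  u+[v-u]≡v [] [] _ = ≡.refl
  u+[v-u]≡v (a ∷ u) (b ∷ v) (p , q) = ≡.cong₂ _∷_ (ℕ.m+[n∸m]≡n p) (u+[v-u]≡v u v q)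

  [u+v]-u≡v : ∀ {k} (u v : Vec ℕ k) → u +ᵥ v -ᵥ u ≡ v
  [u+v]-u≡v [] [] = ≡.refl
  [u+v]-u≡v (a ∷ u) (b ∷ v) = ≡.cong₂ _∷_ (ℕ.m+n∸m≡n a b) ([u+v]-u≡v u v)

  u-[u-v]≡v : ∀ {k} (u v : Vec ℕ k) → v ≤ᵥ u → u -ᵥ (u -ᵥ v) ≡ v
  u-[u-v]≡v [] [] _ = ≡.refl
  u-[u-v]≡v (a ∷ u) (b ∷ v) (p , q) = ≡.cong₂ _∷_ (ℕ.m∸[m∸n]≡n p) (u-[u-v]≡v u v q)

  [u-w]-[v-w]≡u-v : ∀ {k} (u v w : Vec ℕ k) → w ≤ᵥ v → u -ᵥ w -ᵥ (v -ᵥ w) ≡ u -ᵥ v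
  [u-w]-[v-w]≡u-v [] [] [] _ = ≡.refl
  [u-w]-[v-w]≡u-v (a ∷ u) (b ∷ v) (c ∷ w) (p , q) =
    ≡.cong₂ _∷_ (≡.trans (ℕ.∸-+-assoc a c (b ∸ c)) (≡.cong (a ∸_) (ℕ.m+[n∸m]≡n p))) ([u-w]-[v-w]≡u-v u v w q)

  sum-0ᵥ : ∀ k → sum (replicate k 0) ≡ 0
  sum-0ᵥ zero = ≡.refl
  sum-0ᵥ (suc k) = sum-0ᵥ k

  sum≡0⇒≡0ᵥ : ∀ {k} (u : Vec ℕ k) → sum u ≡ 0 → u ≡ 0ᵥ
  sum≡0⇒≡0ᵥ [] _ = ≡.refl
  sum≡0⇒≡0ᵥ (zero ∷ u) p = ≡.cong (0 ∷_) (sum≡0⇒≡0ᵥ u p)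

  sum-+ᵥ : ∀ {k} (u v : Vec ℕ k) → sum (u +ᵥ v) ≡ sum u ℕ.+ sum v
  sum-+ᵥ [] [] = ≡.refl
  sum-+ᵥ (a ∷ u) (b ∷ v) rewrite sum-+ᵥ u v = interchange a b (sum u) (sum v)
    where
    interchange : ∀ a b x y → a ℕ.+ b ℕ.+ (x ℕ.+ y) ≡ a ℕ.+ x ℕ.+ (b ℕ.+ y)
    interchange = solve-∀

  sum[u]+sum[v-u]≡sum[v] : ∀ {k} (u v : Vec ℕ k) → u ≤ᵥ v → sum u ℕ.+ sum (v -ᵥ u) ≡ sum v
  sum[u]+sum[v-u]≡sum[v] u v p = ≡.trans (≡.sym (sum-+ᵥ u (v -ᵥ u))) (≡.cong sum (u+[v-u]≡v u v p))

  sum-mono-≤ᵥ : ∀ {k} (u v : Vec ℕ k) → u ≤ᵥ v → sum u ≤ sum v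
  sum-mono-≤ᵥ [] [] _ = z≤n
  sum-mono-≤ᵥ (a ∷ u) (b ∷ v) (p , q) = ℕ.+-mono-≤ p (sum-mono-≤ᵥ u v q)

  sum≤n⇒≤ᵥreplicate : ∀ {k} (u : Vec ℕ k) n → sum u ≤ n → u ≤ᵥ replicate k n
  sum≤n⇒≤ᵥreplicate [] n _ = tt
  sum≤n⇒≤ᵥreplicate (a ∷ u) n p =
    ℕ.≤-trans (ℕ.m≤m+n a (sum u)) p , sum≤n⇒≤ᵥreplicate u n (ℕ.≤-trans (ℕ.m≤n+m (sum u) a) p)

  Exceeds-replicate⇒<sum : ∀ {k} (u : Vec ℕ k) n → Exceeds u (replicate k n) → n < sum u
  Exceeds-replicate⇒<sum (a ∷ u) n (inj₁ p) = ℕ.≤-trans p (ℕ.m≤m+n a (sum u))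
  Exceeds-replicate⇒<sum (a ∷ u) n (inj₂ p) = ℕ.≤-trans (Exceeds-replicate⇒<sum u n p) (ℕ.m≤n+m (sum u) a)

  Exceeds[v,w-u]⇒Exceeds[u+v,w] : ∀ {k} (u v w : Vec ℕ k) → u ≤ᵥ w → Exceeds v (w -ᵥ u) → Exceeds (u +ᵥ v) w
  Exceeds[v,w-u]⇒Exceeds[u+v,w] [] [] [] _ ()
  Exceeds[v,w-u]⇒Exceeds[u+v,w] (a ∷ u) (b ∷ v) (c ∷ w) (p , q) (inj₁ r) =
    inj₁ (≡.subst (_< a ℕ.+ b) (ℕ.m+[n∸m]≡n p) (ℕ.+-monoʳ-< a r))
  Exceeds[v,w-u]⇒Exceeds[u+v,w] (a ∷ u) (b ∷ v) (c ∷ w) (p , q) (inj₂ r) = inj₂ (Exceeds[v,w-u]⇒Exceeds[u+v,w] u v w q r)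

module FiniteSums {c ℓ} (R : CommutativeRing c ℓ) where
  open PowerSeries R
  open MultiIndex
  open SetoidReasoning setoid
  open import Algebra.Properties.CommutativeSemigroup +-commutativeSemigroup using (interchange)
  open import Algebra.Properties.Ring ring using (-‿+-comm)
  open import Algebra.Properties.Group +-group using (x∙y⁻¹≈ε⇒x≈y; x≈y⇒x∙y⁻¹≈ε)

  *-cong-≈0ˡ : ∀ {a} x y → a ≈ 0# → a * x ≈ a * y
  *-cong-≈0ˡ x y a≈0 = trans (*-congʳ a≈0) (trans (zeroˡ x) (sym (trans (*-congʳ a≈0) (zeroˡ y))))

  *-cong-≈0ʳ : ∀ {a} x y → a ≈ 0# → x * a ≈ y * a
  *-cong-≈0ʳ x y a≈0 = trans (*-comm _ _) (trans (*-cong-≈0ˡ x y a≈0) (*-comm _ _))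

  sumTo-cong : ∀ n {g h} → (∀ i → i ≤ n → g i ≈ h i) → sumTo n g ≈ sumTo n h
  sumTo-cong zero eq = eq 0 z≤n
  sumTo-cong (suc n) eq = +-cong (sumTo-cong n (λ i p → eq i (ℕ.m≤n⇒m≤1+n p))) (eq (suc n) ℕ.≤-refl)

  sumTo-≈0 : ∀ n {g} → (∀ i → i ≤ n → g i ≈ 0#) → sumTo n g ≈ 0#
  sumTo-≈0 n {g} eq = trans (sumTo-cong n eq) (sumTo-const n)
    where
    sumTo-const : ∀ n → sumTo n (λ _ → 0#) ≈ 0#
    sumTo-const zero = refl
    sumTo-const (suc n) = trans (+-identityʳ _) (sumTo-const n)

  sumTo-+ : ∀ n g h → sumTo n (λ i → g i + h i) ≈ sumTo n g + sumTo n h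
  sumTo-+ zero g h = refl
  sumTo-+ (suc n) g h = trans (+-congʳ (sumTo-+ n g h)) (interchange _ _ _ _)

  sumTo-neg : ∀ n g → sumTo n (λ i → - g i) ≈ - sumTo n g
  sumTo-neg zero g = refl
  sumTo-neg (suc n) g = trans (+-congʳ (sumTo-neg n g)) (-‿+-comm _ _)

  *-distribˡ-sumTo : ∀ n a g → a * sumTo n g ≈ sumTo n (λ i → a * g i)
  *-distribˡ-sumTo zero a g = refl
  *-distribˡ-sumTo (suc n) a g = trans (distribˡ _ _ _) (+-congʳ (*-distribˡ-sumTo n a g))

  *-distribʳ-sumTo : ∀ n a g → sumTo n g * a ≈ sumTo n (λ i → g i * a)
  *-distribʳ-sumTo zero a g = refl
  *-distribʳ-sumTo (suc n) a g = trans (distribʳ _ _ _) (+-congʳ (*-distribʳ-sumTo n a g))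

  sumTo-single : ∀ n k {g} → k ≤ n → (∀ i → i ≤ n → i ≢ k → g i ≈ 0#) → sumTo n g ≈ g k
  sumTo-single zero zero p eq = refl
  sumTo-single (suc n) k {g} p eq with k ℕ.≟ suc n
  ... | yes ≡.refl = begin
    sumTo n g + g (suc n) ≈⟨ +-congʳ (sumTo-≈0 n (λ i q → eq i (ℕ.m≤n⇒m≤1+n q) (ℕ.<⇒≢ (s≤s q)))) ⟩
    0# + g (suc n)        ≈⟨ +-identityˡ _ ⟩
    g (suc n)             ∎
  ... | no k≢1+n = begin
    sumTo n g + g (suc n) ≈⟨ +-congˡ (eq (suc n) ℕ.≤-refl (λ e → k≢1+n (≡.sym e))) ⟩
    sumTo n g + 0#        ≈⟨ +-identityʳ _ ⟩
    sumTo n g             ≈⟨ sumTo-single n k (ℕ.≤-pred (ℕ.≤∧≢⇒< p k≢1+n)) (λ i q → eq i (ℕ.m≤n⇒m≤1+n q)) ⟩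
    g k                   ∎

  sumTo-extend : ∀ m n g → m ≤ n → (∀ i → m < i → i ≤ n → g i ≈ 0#) → sumTo n g ≈ sumTo m g
  sumTo-extend m zero g z≤n eq = refl
  sumTo-extend m (suc n) g p eq with ℕ.m≤n⇒m<n∨m≡n p
  ... | inj₂ ≡.refl = refl
  ... | inj₁ (s≤s m≤n) = begin
    sumTo n g + g (suc n) ≈⟨ +-congˡ (eq (suc n) (s≤s m≤n) ℕ.≤-refl) ⟩
    sumTo n g + 0#        ≈⟨ +-identityʳ _ ⟩
    sumTo n g             ≈⟨ sumTo-extend m n g m≤n (λ i a b → eq i a (ℕ.m≤n⇒m≤1+n b)) ⟩
    sumTo m g             ∎

  sumTo-swap : ∀ m n (g : ℕ → ℕ → Carrier) →
    sumTo m (λ i → sumTo n (g i)) ≈ sumTo n (λ j → sumTo m (λ i → g i j))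
  sumTo-swap zero n g = refl
  sumTo-swap (suc m) n g = trans (+-congʳ (sumTo-swap m n g)) (sym (sumTo-+ n _ _))

  sumTo-reverse : ∀ n g → sumTo n g ≈ sumTo n (λ i → g (n ∸ i))
  sumTo-reverse zero g = refl
  sumTo-reverse (suc n) g = begin
    sumTo n g + g (suc n)                          ≈⟨ +-comm _ _ ⟩
    g (suc n) + sumTo n g                          ≈⟨ +-congˡ (sumTo-reverse n g) ⟩
    g (suc n) + sumTo n (λ i → g (n ∸ i))          ≈⟨ shift n (λ i → g (suc n ∸ i)) ⟨
    sumTo (suc n) (λ i → g (suc n ∸ i))            ∎
    where
    shift : ∀ n g → sumTo (suc n) g ≈ g 0 + sumTo n (λ i → g (suc i))
    shift zero g = refl
    shift (suc n) g = trans (+-congʳ (shift n g)) (+-assoc _ _ _)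

  sumTo-triangle : ∀ n (g : ℕ → ℕ → Carrier) →
    sumTo n (λ k → sumTo k (λ i → g i (k ∸ i))) ≈ sumTo n (λ i → sumTo (n ∸ i) (g i))
  sumTo-triangle zero g = refl
  sumTo-triangle (suc n) g = begin
    sumTo n (λ k → sumTo k (λ i → g i (k ∸ i))) + (sumTo n (λ i → g i (suc n ∸ i)) + g (suc n) (n ∸ n))
      ≈⟨ +-congʳ (sumTo-triangle n g) ⟩
    sumTo n (λ i → sumTo (n ∸ i) (g i)) + (sumTo n (λ i → g i (suc n ∸ i)) + g (suc n) (n ∸ n))
      ≈⟨ +-assoc _ _ _ ⟨
    sumTo n (λ i → sumTo (n ∸ i) (g i)) + sumTo n (λ i → g i (suc n ∸ i)) + g (suc n) (n ∸ n)
      ≈⟨ +-cong (sym (sumTo-+ n _ _)) lastColumn ⟩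
    sumTo n (λ i → sumTo (n ∸ i) (g i) + g i (suc n ∸ i)) + sumTo (n ∸ n) (g (suc n))
      ≈⟨ +-congʳ (sumTo-cong n column) ⟩
    sumTo n (λ i → sumTo (suc n ∸ i) (g i)) + sumTo (n ∸ n) (g (suc n)) ∎
    where
    lastColumn : g (suc n) (n ∸ n) ≈ sumTo (n ∸ n) (g (suc n))
    lastColumn rewrite ℕ.n∸n≡0 n = refl
    column : ∀ i → i ≤ n → sumTo (n ∸ i) (g i) + g i (suc n ∸ i) ≈ sumTo (suc n ∸ i) (g i)
    column i p rewrite ℕ.+-∸-assoc 1 p = refl

  sumBox-cong : ∀ {k} (v : Vec ℕ k) {g h} → (∀ d → d ≤ᵥ v → g d ≈ h d) → sumBox v g ≈ sumBox v h
  sumBox-cong [] eq = eq [] tt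
  sumBox-cong (n ∷ v) eq = sumTo-cong n (λ i p → sumBox-cong v (λ d q → eq (i ∷ d) (p , q)))

  sumBox-≈0 : ∀ {k} (v : Vec ℕ k) {g} → (∀ d → d ≤ᵥ v → g d ≈ 0#) → sumBox v g ≈ 0#
  sumBox-≈0 [] eq = eq [] tt
  sumBox-≈0 (n ∷ v) eq = sumTo-≈0 n (λ i p → sumBox-≈0 v (λ d q → eq (i ∷ d) (p , q)))

  sumBox-+ : ∀ {k} (v : Vec ℕ k) g h → sumBox v (λ d → g d + h d) ≈ sumBox v g + sumBox v h
  sumBox-+ [] g h = refl
  sumBox-+ (n ∷ v) g h = trans (sumTo-cong n (λ i _ → sumBox-+ v _ _)) (sumTo-+ n _ _)

  sumBox-neg : ∀ {k} (v : Vec ℕ k) g → sumBox v (λ d → - g d) ≈ - sumBox v g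
  sumBox-neg [] g = refl
  sumBox-neg (n ∷ v) g = trans (sumTo-cong n (λ i _ → sumBox-neg v _)) (sumTo-neg n _)

  sumBox-difference : ∀ {k} (v : Vec ℕ k) g h → sumBox v (λ d → g d - h d) ≈ sumBox v g - sumBox v h
  sumBox-difference v g h = trans (sumBox-+ v _ _) (+-congˡ (sumBox-neg v h))

  *-distribˡ-sumBox : ∀ {k} (v : Vec ℕ k) a g → a * sumBox v g ≈ sumBox v (λ d → a * g d)
  *-distribˡ-sumBox [] a g = refl
  *-distribˡ-sumBox (n ∷ v) a g = trans (*-distribˡ-sumTo n a _) (sumTo-cong n (λ i _ → *-distribˡ-sumBox v a _))

  *-distribʳ-sumBox : ∀ {k} (v : Vec ℕ k) a g → sumBox v g * a ≈ sumBox v (λ d → g d * a)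
  *-distribʳ-sumBox [] a g = refl
  *-distribʳ-sumBox (n ∷ v) a g = trans (*-distribʳ-sumTo n a _) (sumTo-cong n (λ i _ → *-distribʳ-sumBox v a _))

  sumBox-sumTo : ∀ {k} (v : Vec ℕ k) m (g : Vec ℕ k → ℕ → Carrier) →
    sumBox v (λ d → sumTo m (g d)) ≈ sumTo m (λ j → sumBox v (λ d → g d j))
  sumBox-sumTo [] m g = refl
  sumBox-sumTo (n ∷ v) m g = trans (sumTo-cong n (λ i _ → sumBox-sumTo v m _)) (sumTo-swap n m _)

  sumBox-swap : ∀ {k k′} (v : Vec ℕ k) (w : Vec ℕ k′) (g : Vec ℕ k → Vec ℕ k′ → Carrier) →
    sumBox v (λ d → sumBox w (g d)) ≈ sumBox w (λ d′ → sumBox v (λ d → g d d′))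
  sumBox-swap [] w g = refl
  sumBox-swap (n ∷ v) w g = trans (sumTo-cong n (λ i _ → sumBox-swap v w _)) (sym (sumBox-sumTo w n _))

  sumBox-single : ∀ {k} (v u : Vec ℕ k) {g} → u ≤ᵥ v → (∀ d → d ≤ᵥ v → d ≢ u → g d ≈ 0#) → sumBox v g ≈ g u
  sumBox-single [] [] p eq = refl
  sumBox-single (n ∷ v) (a ∷ u) {g} (p , q) eq = trans
    (sumTo-single n a p (λ i r i≢a → sumBox-≈0 v (λ d s → eq (i ∷ d) (r , s) (λ e → i≢a (Vec.∷-injectiveˡ e)))))
    (sumBox-single v u q (λ d s d≢u → eq (a ∷ d) (p , s) (λ e → d≢u (Vec.∷-injectiveʳ e))))

  sumBox-extend : ∀ {k} (v w : Vec ℕ k) g → v ≤ᵥ w → (∀ d → d ≤ᵥ w → Exceeds d v → g d ≈ 0#) →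
    sumBox w g ≈ sumBox v g
  sumBox-extend [] [] g p eq = refl
  sumBox-extend (m ∷ v) (n ∷ w) g (p , q) eq = trans
    (sumTo-cong n (λ i r → sumBox-extend v w _ q (λ d s e → eq (i ∷ d) (r , s) (inj₂ e))))
    (sumTo-extend m n _ p (λ i a b → sumBox-≈0 v (λ d s → eq (i ∷ d) (b , ≤ᵥ-trans d v w s q) (inj₁ a))))

  sumBox-triangle : ∀ {k} (v : Vec ℕ k) (g : Vec ℕ k → Vec ℕ k → Carrier) →
    sumBox v (λ d → sumBox d (λ d₁ → g d₁ (d -ᵥ d₁))) ≈ sumBox v (λ d₁ → sumBox (v -ᵥ d₁) (g d₁))
  sumBox-triangle [] g = refl
  sumBox-triangle (n ∷ v) g = begin
    sumTo n (λ k → sumBox v (λ d → sumTo k (λ i → sumBox d (λ d₁ → g (i ∷ d₁) ((k ∸ i) ∷ (d -ᵥ d₁))))))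
      ≈⟨ sumTo-cong n (λ k _ → sumBox-sumTo v k _) ⟩
    sumTo n (λ k → sumTo k (λ i → sumBox v (λ d → sumBox d (λ d₁ → g (i ∷ d₁) ((k ∸ i) ∷ (d -ᵥ d₁))))))
      ≈⟨ sumTo-cong n (λ k _ → sumTo-cong k (λ i _ → sumBox-triangle v (λ d₁ d₂ → g (i ∷ d₁) ((k ∸ i) ∷ d₂)))) ⟩
    sumTo n (λ k → sumTo k (λ i → sumBox v (λ d₁ → sumBox (v -ᵥ d₁) (λ d₂ → g (i ∷ d₁) ((k ∸ i) ∷ d₂)))))
      ≈⟨ sumTo-triangle n (λ i j → sumBox v (λ d₁ → sumBox (v -ᵥ d₁) (λ d₂ → g (i ∷ d₁) (j ∷ d₂)))) ⟩
    sumTo n (λ i → sumTo (n ∸ i) (λ j → sumBox v (λ d₁ → sumBox (v -ᵥ d₁) (λ d₂ → g (i ∷ d₁) (j ∷ d₂)))))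
      ≈⟨ sumTo-cong n (λ i _ → sym (sumBox-sumTo v (n ∸ i) _)) ⟩
    sumTo n (λ i → sumBox v (λ d₁ → sumTo (n ∸ i) (λ j → sumBox (v -ᵥ d₁) (λ d₂ → g (i ∷ d₁) (j ∷ d₂))))) ∎

  sumBox-reverse : ∀ {k} (v : Vec ℕ k) g → sumBox v g ≈ sumBox v (λ d → g (v -ᵥ d))
  sumBox-reverse [] g = refl
  sumBox-reverse (n ∷ v) g = trans (sumTo-cong n (λ i _ → sumBox-reverse v _)) (sumTo-reverse n _)

  sumBox-cancel : ∀ {k} (v u : Vec ℕ k) g h → u ≤ᵥ v → sumBox v g ≈ sumBox v h →
    (∀ d → d ≤ᵥ v → d ≢ u → g d ≈ h d) → g u ≈ h u
  sumBox-cancel v u g h u≤v sums≈ others≈ = x∙y⁻¹≈ε⇒x≈y _ _ (begin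
    g u - h u                  ≈⟨ sumBox-single v u u≤v (λ d p d≢u → x≈y⇒x∙y⁻¹≈ε (others≈ d p d≢u)) ⟨
    sumBox v (λ d → g d - h d) ≈⟨ sumBox-difference v g h ⟩
    sumBox v g - sumBox v h    ≈⟨ x≈y⇒x∙y⁻¹≈ε sums≈ ⟩
    0#                         ∎)

module SeriesAlgebra {c ℓ} (R : CommutativeRing c ℓ) where
  open PowerSeries R
  open MultiIndex
  open FiniteSums R
  open SetoidReasoning setoid

  ≋-isEquivalence : ∀ {k} → IsEquivalence (_≋_ {k})
  ≋-isEquivalence = record
    { refl = λ _ → refl ; sym = λ p e → sym (p e) ; trans = λ p q e → trans (p e) (q e) }

  ≋-setoid : ℕ → Setoid c ℓ
  ≋-setoid k = record { isEquivalence = ≋-isEquivalence {k} }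

  module ≋ {k} = IsEquivalence (≋-isEquivalence {k})

  𝟙-0ᵥ : ∀ k → 𝟙 (replicate k 0) ≈ 1#
  𝟙-0ᵥ zero = refl
  𝟙-0ᵥ (suc k) = 𝟙-0ᵥ k

  𝟙-≢0ᵥ : ∀ {k} (d : Vec ℕ k) → d ≢ 0ᵥ → 𝟙 d ≈ 0#
  𝟙-≢0ᵥ [] d≢0 = ⊥-elim (d≢0 ≡.refl)
  𝟙-≢0ᵥ (zero ∷ d) d≢0 = 𝟙-≢0ᵥ d (λ e → d≢0 (≡.cong (0 ∷_) e))
  𝟙-≢0ᵥ (suc _ ∷ d) d≢0 = refl

  ⋆-cong : ∀ {k} {f f′ g g′ : Series k} → f ≋ f′ → g ≋ g′ → (f ⋆ g) ≋ (f′ ⋆ g′)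
  ⋆-cong p q e = sumBox-cong e (λ d _ → *-cong (p d) (q _))

  ⋆-congˡ : ∀ {k} (f : Series k) {g g′ : Series k} → g ≋ g′ → (f ⋆ g) ≋ (f ⋆ g′)
  ⋆-congˡ f = ⋆-cong {f = f} ≋.refl

  ⋆-congʳ : ∀ {k} (g : Series k) {f f′ : Series k} → f ≋ f′ → (f ⋆ g) ≋ (f′ ⋆ g)
  ⋆-congʳ g p = ⋆-cong {g = g} p ≋.refl

  ⋆-identityˡ : ∀ {k} (f : Series k) → (𝟙 ⋆ f) ≋ f
  ⋆-identityˡ {k} f e = begin
    sumBox e (λ d → 𝟙 d * f (e -ᵥ d))
      ≈⟨ sumBox-single e (0ᵥ {k}) (0ᵥ≤ᵥ e) (λ d _ d≢0 → trans (*-congʳ (𝟙-≢0ᵥ d d≢0)) (zeroˡ _)) ⟩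
    𝟙 (0ᵥ {k}) * f (e -ᵥ 0ᵥ) ≈⟨ *-cong (𝟙-0ᵥ k) (reflexive (≡.cong f (u-0≡u e))) ⟩
    1# * f e                ≈⟨ *-identityˡ _ ⟩
    f e                     ∎

  ⋆-comm : ∀ {k} (f g : Series k) → (f ⋆ g) ≋ (g ⋆ f)
  ⋆-comm f g e = begin
    sumBox e (λ d → f d * g (e -ᵥ d))                ≈⟨ sumBox-reverse e _ ⟩
    sumBox e (λ d → f (e -ᵥ d) * g (e -ᵥ (e -ᵥ d)))  ≈⟨ sumBox-cong e (λ d p → trans
                                                          (*-congˡ (reflexive (≡.cong g (u-[u-v]≡v e d p)))) (*-comm _ _)) ⟩
    sumBox e (λ d → g d * f (e -ᵥ d))                ∎

  ⋆-identityʳ : ∀ {k} (f : Series k) → (f ⋆ 𝟙) ≋ f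
  ⋆-identityʳ f e = trans (⋆-comm f 𝟙 e) (⋆-identityˡ f e)

  ⋆-assoc : ∀ {k} (f g h : Series k) → ((f ⋆ g) ⋆ h) ≋ (f ⋆ (g ⋆ h))
  ⋆-assoc f g h e = begin
    sumBox e (λ d → sumBox d (λ d₁ → f d₁ * g (d -ᵥ d₁)) * h (e -ᵥ d))
      ≈⟨ sumBox-cong e (λ d _ → trans (*-distribʳ-sumBox d _ _) (sumBox-cong d (λ d₁ q →
           trans (*-assoc _ _ _) (*-congˡ (*-congˡ (reflexive (≡.cong h (≡.sym ([u-w]-[v-w]≡u-v e d d₁ q))))))))) ⟩
    sumBox e (λ d → sumBox d (λ d₁ → term d₁ (d -ᵥ d₁)))
      ≈⟨ sumBox-triangle e term ⟩
    sumBox e (λ d₁ → sumBox (e -ᵥ d₁) (term d₁))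
      ≈⟨ sumBox-cong e (λ d₁ _ → sym (*-distribˡ-sumBox (e -ᵥ d₁) _ _)) ⟩
    sumBox e (λ d₁ → f d₁ * sumBox (e -ᵥ d₁) (λ d₂ → g d₂ * h (e -ᵥ d₁ -ᵥ d₂))) ∎
    where
    term = λ d₁ d₂ → f d₁ * (g d₂ * h (e -ᵥ d₁ -ᵥ d₂))

  ⋆-zeroˡ : ∀ {k} (f : Series k) → (𝟘 ⋆ f) ≋ 𝟘
  ⋆-zeroˡ f e = sumBox-≈0 e (λ d _ → zeroˡ _)

  ⋆-isCommutativeMonoid : ∀ {k} → IsCommutativeMonoid (_≋_ {k}) _⋆_ 𝟙
  ⋆-isCommutativeMonoid = record
    { isMonoid = record
      { isSemigroup = record
        { isMagma = record { isEquivalence = ≋-isEquivalence ; ∙-cong = ⋆-cong }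
        ; assoc = ⋆-assoc }
      ; identity = ⋆-identityˡ , ⋆-identityʳ }
    ; comm = ⋆-comm }

  ⋆-commutativeMonoid : ℕ → CommutativeMonoid c ℓ
  ⋆-commutativeMonoid k = record { isCommutativeMonoid = ⋆-isCommutativeMonoid {k} }

  ⋆-interchange : ∀ {k} (f g h i : Series k) → ((f ⋆ g) ⋆ (h ⋆ i)) ≋ ((f ⋆ h) ⋆ (g ⋆ i))
  ⋆-interchange {k} = interchange
    where open import Algebra.Properties.CommutativeSemigroup
            (CommutativeMonoid.commutativeSemigroup (⋆-commutativeMonoid k))

  ^-cong : ∀ {k} {f g : Series k} → f ≋ g → ∀ n → (f ^ˢ n) ≋ (g ^ˢ n)
  ^-cong p zero = ≋.refl
  ^-cong p (suc n) = ⋆-cong p (^-cong p n)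

  ^-+ : ∀ {k} (f : Series k) m n → (f ^ˢ (m ℕ.+ n)) ≋ ((f ^ˢ m) ⋆ (f ^ˢ n))
  ^-+ f zero n = ≋.sym (⋆-identityˡ _)
  ^-+ f (suc m) n = ≋.trans (⋆-congˡ f (^-+ f m n)) (≋.sym (⋆-assoc f (f ^ˢ m) (f ^ˢ n)))

  ^-* : ∀ {k} (f : Series k) m n → ((f ^ˢ m) ^ˢ n) ≋ (f ^ˢ (m ℕ.* n))
  ^-* f m zero rewrite ℕ.*-zeroʳ m = ≋.refl
  ^-* f m (suc n) rewrite ℕ.*-suc m n = ≋.trans (⋆-congˡ (f ^ˢ m) (^-* f m n)) (≋.sym (^-+ f m (m ℕ.* n)))

module Monomials {c ℓ} (R : CommutativeRing c ℓ) where
  open PowerSeries R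
  open MultiIndex
  open FiniteSums R
  open SeriesAlgebra R
  open SetoidReasoning setoid

  unit : ∀ {k} → Fin k → Vec ℕ k
  unit zero = 1 ∷ 0ᵥ
  unit (suc i) = 0 ∷ unit i

  sum-unit : ∀ {k} (i : Fin k) → sum (unit i) ≡ 1
  sum-unit {suc k} zero = ≡.cong suc (sum-0ᵥ k)
  sum-unit (suc i) = sum-unit i

  var-unit : ∀ {k} (i : Fin k) → var i (unit i) ≈ 1#
  var-unit {suc k} zero = 𝟙-0ᵥ k
  var-unit (suc i) = var-unit i

  var-≢unit : ∀ {k} (i : Fin k) d → d ≢ unit i → var i d ≈ 0#
  var-≢unit zero (zero ∷ d) _ = refl
  var-≢unit zero (suc zero ∷ d) d≢1 = 𝟙-≢0ᵥ d (λ e → d≢1 (≡.cong (1 ∷_) e))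
  var-≢unit zero (suc (suc _) ∷ d) _ = refl
  var-≢unit (suc i) (zero ∷ d) d≢1 = var-≢unit i d (λ e → d≢1 (≡.cong (0 ∷_) e))
  var-≢unit (suc i) (suc _ ∷ d) _ = refl

  _≟ᵥ_ : ∀ {k} (u v : Vec ℕ k) → Dec (u ≡ v)
  _≟ᵥ_ = Vec.≡-dec ℕ._≟_

  monomial : ∀ {k} → Vec ℕ k → Series k
  monomial u e with e ≟ᵥ u
  ... | yes _ = 1#
  ... | no _ = 0#

  monomial-≡ : ∀ {k} (u e : Vec ℕ k) → e ≡ u → monomial u e ≈ 1#
  monomial-≡ u e e≡u with e ≟ᵥ u
  ... | yes _ = refl
  ... | no e≢u = ⊥-elim (e≢u e≡u)

  monomial-≢ : ∀ {k} (u e : Vec ℕ k) → e ≢ u → monomial u e ≈ 0#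
  monomial-≢ u e e≢u with e ≟ᵥ u
  ... | yes e≡u = ⊥-elim (e≢u e≡u)
  ... | no _ = refl

  monomial-cong : ∀ {k} {u v : Vec ℕ k} → u ≡ v → monomial u ≋ monomial v
  monomial-cong ≡.refl = ≋.refl

  monomial-⋆ : ∀ {k} (u v : Vec ℕ k) → (monomial u ⋆ monomial v) ≋ monomial (u +ᵥ v)
  monomial-⋆ u v e with u ≤ᵥ? e
  ... | yes u≤e = begin
    sumBox e (λ d → monomial u d * monomial v (e -ᵥ d))
      ≈⟨ sumBox-single e u u≤e (λ d _ d≢u → trans (*-congʳ (monomial-≢ u d d≢u)) (zeroˡ _)) ⟩
    monomial u u * monomial v (e -ᵥ u) ≈⟨ trans (*-congʳ (monomial-≡ u u ≡.refl)) (*-identityˡ _) ⟩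
    monomial v (e -ᵥ u)                ≈⟨ shift ⟩
    monomial (u +ᵥ v) e                ∎
    where
    shift : monomial v (e -ᵥ u) ≈ monomial (u +ᵥ v) e
    shift with e ≟ᵥ (u +ᵥ v)
    ... | yes ≡.refl = monomial-≡ v _ ([u+v]-u≡v u v)
    ... | no e≢u+v = monomial-≢ v _ (λ q → e≢u+v (≡.trans (≡.sym (u+[v-u]≡v u e u≤e)) (≡.cong (u +ᵥ_) q)))
  ... | no u≰e = begin
    sumBox e (λ d → monomial u d * monomial v (e -ᵥ d))
      ≈⟨ sumBox-≈0 e (λ d d≤e → trans (*-congʳ (monomial-≢ u d (λ { ≡.refl → u≰e d≤e }))) (zeroˡ _)) ⟩
    0#                  ≈⟨ monomial-≢ (u +ᵥ v) e (λ { ≡.refl → u≰e (u≤ᵥu+v u v) }) ⟨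
    monomial (u +ᵥ v) e ∎

  𝟙≋monomial : ∀ {k} → 𝟙 {k} ≋ monomial 0ᵥ
  𝟙≋monomial {k} e with e ≟ᵥ 0ᵥ
  ... | yes ≡.refl = 𝟙-0ᵥ k
  ... | no e≢0 = 𝟙-≢0ᵥ e e≢0

  var≋monomial : ∀ {k} (i : Fin k) → var i ≋ monomial (unit i)
  var≋monomial i e with e ≟ᵥ unit i
  ... | yes ≡.refl = var-unit i
  ... | no e≢1 = var-≢unit i e e≢1

  τ^≋monomial : ∀ n → (τ ^ˢ n) ≋ monomial (n ∷ [])
  τ^≋monomial zero = 𝟙≋monomial
  τ^≋monomial (suc n) = ≋.trans (⋆-cong (var≋monomial zero) (τ^≋monomial n)) (monomial-⋆ (1 ∷ []) (n ∷ []))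

  X′^≋monomial : ∀ n → (X' ^ˢ n) ≋ monomial (n ∷ 0 ∷ [])
  X′^≋monomial zero = 𝟙≋monomial
  X′^≋monomial (suc n) =
    ≋.trans (⋆-cong (var≋monomial zero) (X′^≋monomial n)) (monomial-⋆ (1 ∷ 0 ∷ []) (n ∷ 0 ∷ []))

  Y′^≋monomial : ∀ n → (Y' ^ˢ n) ≋ monomial (0 ∷ n ∷ [])
  Y′^≋monomial zero = 𝟙≋monomial
  Y′^≋monomial (suc n) =
    ≋.trans (⋆-cong (var≋monomial (suc zero)) (Y′^≋monomial n)) (monomial-⋆ (0 ∷ 1 ∷ []) (0 ∷ n ∷ []))

module Order {c ℓ} (R : CommutativeRing c ℓ) where
  open PowerSeries R
  open MultiIndex
  open FiniteSums R
  open SeriesAlgebra R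
  open Monomials R

  Ord≥ : ∀ {k} → ℕ → Series k → Set ℓ
  Ord≥ n f = ∀ e → sum e < n → f e ≈ 0#

  Ord≥-cong : ∀ {k} {f g : Series k} n → f ≋ g → Ord≥ n f → Ord≥ n g
  Ord≥-cong n f≋g o e lt = trans (sym (f≋g e)) (o e lt)

  Ord≥-weaken : ∀ {k} {f : Series k} {m n} → m ≤ n → Ord≥ n f → Ord≥ m f
  Ord≥-weaken m≤n o e lt = o e (ℕ.<-≤-trans lt m≤n)

  const≈0⇒Ord≥1 : ∀ {k} (f : Series k) → const f ≈ 0# → Ord≥ 1 f
  const≈0⇒Ord≥1 f f0≈0 e lt = trans (reflexive (≡.cong f (sum≡0⇒≡0ᵥ e (ℕ.n<1⇒n≡0 lt)))) f0≈0

  Ord≥1⇒const≈0 : ∀ {k} (f : Series k) → Ord≥ 1 f → const f ≈ 0#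
  Ord≥1⇒const≈0 {k} f o = o 0ᵥ (≡.subst (_< 1) (≡.sym (sum-0ᵥ k)) (s≤s z≤n))

  Ord≥-⋆ : ∀ {k} m n {f g : Series k} → Ord≥ m f → Ord≥ n g → Ord≥ (m ℕ.+ n) (f ⋆ g)
  Ord≥-⋆ m n {f} {g} of og e lt = sumBox-≈0 e term≈0
    where
    term≈0 : ∀ d → d ≤ᵥ e → f d * g (e -ᵥ d) ≈ 0#
    term≈0 d d≤e with sum d ℕ.<? m
    ... | yes d<m = trans (*-congʳ (of d d<m)) (zeroˡ _)
    ... | no d≮m = trans (*-congˡ (og (e -ᵥ d) rest<n)) (zeroʳ _)
      where
      rest<n : sum (e -ᵥ d) < n
      rest<n = ℕ.+-cancelˡ-< m _ _ (ℕ.≤-<-trans (ℕ.+-monoˡ-≤ (sum (e -ᵥ d)) (ℕ.≮⇒≥ d≮m))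
                 (≡.subst (_< m ℕ.+ n) (≡.sym (sum[u]+sum[v-u]≡sum[v] d e d≤e)) lt))

  Ord≥-^ : ∀ {k} {f : Series k} → Ord≥ 1 f → ∀ n → Ord≥ n (f ^ˢ n)
  Ord≥-^ o zero e ()
  Ord≥-^ o (suc n) = Ord≥-⋆ 1 n o (Ord≥-^ o n)

  Ord≥1-^suc : ∀ {k} {f : Series k} → Ord≥ 1 f → ∀ n → Ord≥ 1 (f ^ˢ suc n)
  Ord≥1-^suc o n = Ord≥-weaken (s≤s z≤n) (Ord≥-^ o (suc n))

  Ord≥1-var : ∀ {k} (i : Fin k) → Ord≥ 1 (var i)
  Ord≥1-var {k} i = const≈0⇒Ord≥1 (var i) (var-≢unit i 0ᵥ (λ 0≡1 → 0≢1 (≡.trans (≡.sym (sum-0ᵥ k))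
    (≡.trans (≡.cong sum 0≡1) (sum-unit i)))))
    where
    0≢1 : 0 ≢ 1
    0≢1 ()

  Ord≥1-τ : Ord≥ 1 τ
  Ord≥1-τ = Ord≥1-var zero

  infix 4 _≋[<_]_

  _≋[<_]_ : ∀ {k} → Series k → ℕ → Series k → Set ℓ
  f ≋[< n ] g = ∀ e → sum e < n → f e ≈ g e

  ≋[<]-refl : ∀ {k n} {f : Series k} → f ≋[< n ] f
  ≋[<]-refl e _ = refl

  ≋[<]-trans : ∀ {k n} {f g h : Series k} → f ≋[< n ] g → g ≋[< n ] h → f ≋[< n ] h
  ≋[<]-trans p q e lt = trans (p e lt) (q e lt)

  ≋⇒≋[<] : ∀ {k n} {f g : Series k} → f ≋ g → f ≋[< n ] g
  ≋⇒≋[<] p e _ = p e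

  ≋[<]-weaken : ∀ {k m n} {f g : Series k} → m ≤ n → f ≋[< n ] g → f ≋[< m ] g
  ≋[<]-weaken m≤n p e lt = p e (ℕ.<-≤-trans lt m≤n)

  ≋[<]-⋆ : ∀ {k n} {f f′ g g′ : Series k} → f ≋[< n ] f′ → g ≋[< n ] g′ → (f ⋆ g) ≋[< n ] (f′ ⋆ g′)
  ≋[<]-⋆ p q e lt = sumBox-cong e (λ d d≤e →
    *-cong (p d (ℕ.≤-<-trans (sum-mono-≤ᵥ d e d≤e) lt)) (q _ (ℕ.≤-<-trans (sum-mono-≤ᵥ _ e (u-v≤ᵥu e d)) lt)))

  ≋[<]-^ : ∀ {k n} {f f′ : Series k} → f ≋[< n ] f′ → ∀ j → (f ^ˢ j) ≋[< n ] (f′ ^ˢ j)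
  ≋[<]-^ p zero = ≋[<]-refl
  ≋[<]-^ p (suc j) = ≋[<]-⋆ p (≋[<]-^ p j)

  ≋[<]-Ord≥1⋆ : ∀ {k n} {f g g′ : Series k} → Ord≥ 1 f → g ≋[< n ] g′ → (f ⋆ g) ≋[< suc n ] (f ⋆ g′)
  ≋[<]-Ord≥1⋆ {n = n} {f} {g} {g′} of p e lt = sumBox-cong e term≈
    where
    term≈ : ∀ d → d ≤ᵥ e → f d * g (e -ᵥ d) ≈ f d * g′ (e -ᵥ d)
    term≈ d d≤e with sum d ℕ.<? 1
    ... | yes d<1 = *-cong-≈0ˡ _ _ (of d d<1)
    ... | no d≮1 = *-congˡ (p _ (ℕ.≤-trans (ℕ.+-monoˡ-≤ (sum (e -ᵥ d)) (ℕ.≮⇒≥ d≮1))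
                     (≡.subst (_≤ n) (≡.sym (sum[u]+sum[v-u]≡sum[v] d e d≤e)) (ℕ.≤-pred lt))))

module Evaluation {c ℓ} (R : CommutativeRing c ℓ) where
  open PowerSeries R
  open MultiIndex
  open FiniteSums R
  open SeriesAlgebra R
  open Monomials R
  open Order R
  open SetoidReasoning setoid
  open import Algebra.Properties.CommutativeSemigroup *-commutativeSemigroup
    using () renaming (interchange to *-interchange)

  _^ᵛ_ : ∀ {n k} → Vec (Series k) n → Vec ℕ n → Series k
  [] ^ᵛ [] = 𝟙
  (h ∷ hs) ^ᵛ (d ∷ ds) = (h ^ˢ d) ⋆ (hs ^ᵛ ds)

  ^ᵛ-cong : ∀ {n k} {hs gs : Vec (Series k) n} → Pointwise _≋_ hs gs → ∀ d → (hs ^ᵛ d) ≋ (gs ^ᵛ d)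
  ^ᵛ-cong [] [] = ≋.refl
  ^ᵛ-cong (p ∷ ps) (d ∷ ds) = ⋆-cong (^-cong p d) (^ᵛ-cong ps ds)

  ^ᵛ-0ᵥ : ∀ {n k} (hs : Vec (Series k) n) → (hs ^ᵛ 0ᵥ) ≋ 𝟙
  ^ᵛ-0ᵥ [] = ≋.refl
  ^ᵛ-0ᵥ (h ∷ hs) = ≋.trans (⋆-identityˡ _) (^ᵛ-0ᵥ hs)

  ^ᵛ-+ᵥ : ∀ {n k} (hs : Vec (Series k) n) d₁ d₂ → (hs ^ᵛ (d₁ +ᵥ d₂)) ≋ ((hs ^ᵛ d₁) ⋆ (hs ^ᵛ d₂))
  ^ᵛ-+ᵥ [] [] [] = ≋.sym (⋆-identityˡ 𝟙)
  ^ᵛ-+ᵥ (h ∷ hs) (a ∷ d₁) (b ∷ d₂) =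
    ≋.trans (⋆-cong (^-+ h a b) (^ᵛ-+ᵥ hs d₁ d₂)) (⋆-interchange (h ^ˢ a) (h ^ˢ b) (hs ^ᵛ d₁) (hs ^ᵛ d₂))

  ^ᵛ-unit : ∀ {n k} (hs : Vec (Series k) n) (i : Fin n) → (hs ^ᵛ unit i) ≋ lookup hs i
  ^ᵛ-unit (h ∷ hs) zero = ≋.trans (⋆-cong (⋆-identityʳ h) (^ᵛ-0ᵥ hs)) (⋆-identityʳ h)
  ^ᵛ-unit (h ∷ hs) (suc i) = ≋.trans (⋆-identityˡ _) (^ᵛ-unit hs i)

  Ord≥-^ᵛ : ∀ {n k} {hs : Vec (Series k) n} → All (Ord≥ 1) hs → ∀ d → Ord≥ (sum d) (hs ^ᵛ d)
  Ord≥-^ᵛ [] [] e ()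
  Ord≥-^ᵛ (o ∷ os) (d ∷ ds) = Ord≥-⋆ d (sum ds) (Ord≥-^ o d) (Ord≥-^ᵛ os ds)

  evalUpTo : ∀ {n k} → ℕ → Series n → Vec (Series k) n → Series k
  evalUpTo {n} N G hs e = sumBox (replicate n N) (λ d → G d * (hs ^ᵛ d) e)

  -- G(h₁, …, hₙ).  As in `subst`, the coefficient at e only reads the exponents
  -- d ≤ (|e|, …, |e|) of G, which suffices when every hᵢ has order ≥ 1.
  eval : ∀ {n k} → Series n → Vec (Series k) n → Series k
  eval G hs e = evalUpTo (sum e) G hs e

  evalUpTo≈eval : ∀ {n k} N G {hs : Vec (Series k) n} → All (Ord≥ 1) hs →
    ∀ e → sum e ≤ N → evalUpTo N G hs e ≈ eval G hs e
  evalUpTo≈eval {n} N G os e e≤N = sumBox-extend (replicate n (sum e)) (replicate n N) _ (replicate-mono-≤ᵥ n e≤N)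
    (λ d _ d≰ → trans (*-congˡ (Ord≥-^ᵛ os d e (Exceeds-replicate⇒<sum d (sum e) d≰))) (zeroʳ _))

  eval-congˡ : ∀ {n k} {G G′ : Series n} → G ≋ G′ → (hs : Vec (Series k) n) → eval G hs ≋ eval G′ hs
  eval-congˡ {n} G≋G′ hs e = sumBox-cong (replicate n (sum e)) (λ d _ → *-congʳ (G≋G′ d))

  eval-congʳ : ∀ {n k} (G : Series n) {hs gs : Vec (Series k) n} → Pointwise _≋_ hs gs → eval G hs ≋ eval G gs
  eval-congʳ {n} G hs≋gs e = sumBox-cong (replicate n (sum e)) (λ d _ → *-congˡ (^ᵛ-cong hs≋gs d e))

  eval-𝟘 : ∀ {n k} (hs : Vec (Series k) n) → eval 𝟘 hs ≋ 𝟘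
  eval-𝟘 {n} hs e = sumBox-≈0 (replicate n (sum e)) (λ d _ → zeroˡ _)

  eval-𝟙 : ∀ {n k} (hs : Vec (Series k) n) → eval 𝟙 hs ≋ 𝟙
  eval-𝟙 {n} hs e = begin
    sumBox (replicate n (sum e)) (λ d → 𝟙 d * (hs ^ᵛ d) e)
      ≈⟨ sumBox-single (replicate n (sum e)) (0ᵥ {n}) (0ᵥ≤ᵥ _) (λ d _ d≢0 → trans (*-congʳ (𝟙-≢0ᵥ d d≢0)) (zeroˡ _)) ⟩
    𝟙 (0ᵥ {n}) * (hs ^ᵛ 0ᵥ) e ≈⟨ *-cong (𝟙-0ᵥ n) (^ᵛ-0ᵥ hs e) ⟩
    1# * 𝟙 e                 ≈⟨ *-identityˡ _ ⟩
    𝟙 e                      ∎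

  eval-var : ∀ {n k} (i : Fin n) {hs : Vec (Series k) n} → All (Ord≥ 1) hs → eval (var i) hs ≋ lookup hs i
  eval-var {n} i {hs} os e = begin
    eval (var i) hs e
      ≈⟨ evalUpTo≈eval (suc (sum e)) (var i) os e (ℕ.n≤1+n _) ⟨
    sumBox (replicate n (suc (sum e))) (λ d → var i d * (hs ^ᵛ d) e)
      ≈⟨ sumBox-single _ (unit i) (sum≤n⇒≤ᵥreplicate (unit i) _ (≡.subst (_≤ suc (sum e)) (≡.sym (sum-unit i)) (s≤s z≤n)))
           (λ d _ d≢1 → trans (*-congʳ (var-≢unit i d d≢1)) (zeroˡ _)) ⟩
    var i (unit i) * (hs ^ᵛ unit i) e ≈⟨ *-cong (var-unit i) (^ᵛ-unit hs i e) ⟩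
    1# * lookup hs i e                ≈⟨ *-identityˡ _ ⟩
    lookup hs i e                     ∎

  Ord≥1-eval : ∀ {n k} {G : Series n} (hs : Vec (Series k) n) → Ord≥ 1 G → Ord≥ 1 (eval G hs)
  Ord≥1-eval {n} hs o e lt = sumBox-≈0 (replicate n (sum e)) (λ d d≤ → trans (*-congʳ (o d (d<1 d d≤))) (zeroˡ _))
    where
    d<1 : ∀ d → d ≤ᵥ replicate n (sum e) → sum d < 1
    d<1 d d≤ rewrite ℕ.n<1⇒n≡0 lt = s≤s (≡.subst (sum d ≤_) (sum-0ᵥ n) (sum-mono-≤ᵥ d _ d≤))

  eval-linear : ∀ {n k m} (v : Vec ℕ m) (a : Vec ℕ m → Carrier) (G : Vec ℕ m → Series n) (hs : Vec (Series k) n) e →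
    eval (λ x → sumBox v (λ d → a d * G d x)) hs e ≈ sumBox v (λ d → a d * eval (G d) hs e)
  eval-linear {n} v a G hs e = begin
    sumBox W (λ d′ → sumBox v (λ d → a d * G d d′) * (hs ^ᵛ d′) e)
      ≈⟨ sumBox-cong W (λ d′ _ → trans (*-distribʳ-sumBox v _ _) (sumBox-cong v (λ d _ → *-assoc _ _ _))) ⟩
    sumBox W (λ d′ → sumBox v (λ d → a d * (G d d′ * (hs ^ᵛ d′) e)))
      ≈⟨ sumBox-swap W v _ ⟩
    sumBox v (λ d → sumBox W (λ d′ → a d * (G d d′ * (hs ^ᵛ d′) e)))
      ≈⟨ sumBox-cong v (λ d _ → sym (*-distribˡ-sumBox W _ _)) ⟩
    sumBox v (λ d → a d * eval (G d) hs e) ∎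
    where W = replicate n (sum e)

  eval-⋆ : ∀ {n k} (A B : Series n) {hs : Vec (Series k) n} → All (Ord≥ 1) hs →
    eval (A ⋆ B) hs ≋ (eval A hs ⋆ eval B hs)
  eval-⋆ {n} A B {hs} os e = trans lhs (sym rhs)
    where
    V = replicate n (sum e)
    term = λ d₁ d₂ → (A d₁ * B d₂) * (hs ^ᵛ (d₁ +ᵥ d₂)) e

    lhs : eval (A ⋆ B) hs e ≈ sumBox V (λ d₁ → sumBox V (term d₁))
    lhs = begin
      sumBox V (λ d → sumBox d (λ d₁ → A d₁ * B (d -ᵥ d₁)) * (hs ^ᵛ d) e)
        ≈⟨ sumBox-cong V (λ d _ → trans (*-distribʳ-sumBox d _ _) (sumBox-cong d (λ d₁ d₁≤d →
             *-congˡ (reflexive (≡.cong (λ u → (hs ^ᵛ u) e) (≡.sym (u+[v-u]≡v d₁ d d₁≤d))))))) ⟩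
      sumBox V (λ d → sumBox d (λ d₁ → term d₁ (d -ᵥ d₁)))
        ≈⟨ sumBox-triangle V term ⟩
      sumBox V (λ d₁ → sumBox (V -ᵥ d₁) (term d₁))
        ≈⟨ sumBox-cong V (λ d₁ d₁≤V → sym (sumBox-extend (V -ᵥ d₁) V _ (u-v≤ᵥu V d₁)
             (λ d₂ _ d₂≰ → trans (*-congˡ (Ord≥-^ᵛ os (d₁ +ᵥ d₂) e (Exceeds-replicate⇒<sum (d₁ +ᵥ d₂) (sum e)
                (Exceeds[v,w-u]⇒Exceeds[u+v,w] d₁ d₂ V d₁≤V d₂≰)))) (zeroʳ _)))) ⟩
      sumBox V (λ d₁ → sumBox V (term d₁)) ∎

    rhs : (eval A hs ⋆ eval B hs) e ≈ sumBox V (λ d₁ → sumBox V (term d₁))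
    rhs = begin
      sumBox e (λ d → eval A hs d * eval B hs (e -ᵥ d))
        ≈⟨ sumBox-cong e (λ d d≤e → *-cong
             (sym (evalUpTo≈eval (sum e) A os d (sum-mono-≤ᵥ d e d≤e)))
             (sym (evalUpTo≈eval (sum e) B os (e -ᵥ d) (sum-mono-≤ᵥ (e -ᵥ d) e (u-v≤ᵥu e d))))) ⟩
      sumBox e (λ d → evalUpTo (sum e) A hs d * evalUpTo (sum e) B hs (e -ᵥ d))
        ≈⟨ sumBox-cong e (λ d _ → trans (*-distribʳ-sumBox V _ _) (sumBox-cong V (λ d₁ _ → *-distribˡ-sumBox V _ _))) ⟩
      sumBox e (λ d → sumBox V (λ d₁ → sumBox V (λ d₂ → (A d₁ * (hs ^ᵛ d₁) d) * (B d₂ * (hs ^ᵛ d₂) (e -ᵥ d)))))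
        ≈⟨ sumBox-cong e (λ d _ → sumBox-cong V (λ d₁ _ → sumBox-cong V (λ d₂ _ → *-interchange _ _ _ _))) ⟩
      sumBox e (λ d → sumBox V (λ d₁ → sumBox V (λ d₂ → (A d₁ * B d₂) * ((hs ^ᵛ d₁) d * (hs ^ᵛ d₂) (e -ᵥ d)))))
        ≈⟨ trans (sumBox-swap e V _) (sumBox-cong V (λ d₁ _ → sumBox-swap e V _)) ⟩
      sumBox V (λ d₁ → sumBox V (λ d₂ → sumBox e (λ d → (A d₁ * B d₂) * ((hs ^ᵛ d₁) d * (hs ^ᵛ d₂) (e -ᵥ d)))))
        ≈⟨ sumBox-cong V (λ d₁ _ → sumBox-cong V (λ d₂ _ → trans (sym (*-distribˡ-sumBox e _ _))
             (*-congˡ (sym (^ᵛ-+ᵥ hs d₁ d₂ e))))) ⟩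
      sumBox V (λ d₁ → sumBox V (term d₁)) ∎

  eval-^ : ∀ {n k} (G : Series n) {hs : Vec (Series k) n} → All (Ord≥ 1) hs →
    ∀ j → eval (G ^ˢ j) hs ≋ (eval G hs ^ˢ j)
  eval-^ G {hs} os zero = eval-𝟙 hs
  eval-^ G {hs} os (suc j) = ≋.trans (eval-⋆ G (G ^ˢ j) os) (⋆-congˡ (eval G hs) (eval-^ G os j))

  eval-^ᵛ : ∀ {n m k} (gs : Vec (Series m) n) {hs : Vec (Series k) m} → All (Ord≥ 1) hs →
    ∀ d → eval (gs ^ᵛ d) hs ≋ (map (λ g → eval g hs) gs ^ᵛ d)
  eval-^ᵛ [] {hs} os [] = eval-𝟙 hs
  eval-^ᵛ (g ∷ gs) os (d ∷ ds) = ≋.trans (eval-⋆ (g ^ˢ d) (gs ^ᵛ ds) os) (⋆-cong (eval-^ g os d) (eval-^ᵛ gs os ds))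

  eval-eval : ∀ {n m k} (G : Series n) {gs : Vec (Series m) n} {hs : Vec (Series k) m} →
    All (Ord≥ 1) gs → All (Ord≥ 1) hs → eval (eval G gs) hs ≋ eval G (map (λ g → eval g hs) gs)
  eval-eval {n} {m} G {gs} {hs} ogs ohs e = begin
    sumBox (replicate m (sum e)) (λ d′ → eval G gs d′ * (hs ^ᵛ d′) e)
      ≈⟨ sumBox-cong (replicate m (sum e)) (λ d′ _ → truncate d′) ⟩
    eval (λ x → sumBox V (λ d → G d * (gs ^ᵛ d) x)) hs e
      ≈⟨ eval-linear V G (gs ^ᵛ_) hs e ⟩
    sumBox V (λ d → G d * eval (gs ^ᵛ d) hs e)
      ≈⟨ sumBox-cong V (λ d _ → *-congˡ (eval-^ᵛ gs ohs d e)) ⟩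
    sumBox V (λ d → G d * (map (λ g → eval g hs) gs ^ᵛ d) e) ∎
    where
    V = replicate n (sum e)
    truncate : ∀ d′ → eval G gs d′ * (hs ^ᵛ d′) e ≈ evalUpTo (sum e) G gs d′ * (hs ^ᵛ d′) e
    truncate d′ with sum d′ ℕ.≤? sum e
    ... | yes d′≤e = *-congʳ (sym (evalUpTo≈eval (sum e) G ogs d′ d′≤e))
    ... | no d′≰e = *-cong-≈0ʳ _ _ (Ord≥-^ᵛ ohs d′ e (ℕ.≰⇒> d′≰e))

digits-unique : ∀ {M a b i j} → a < M → i ℕ.+ M ℕ.* j ≡ a ℕ.+ M ℕ.* b → b ≤ j → i ≡ a × j ≡ b
digits-unique {M} {a} {b} {i} a<M eq b≤j with ℕ.m≤n⇒∃[o]m+o≡n b≤j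
... | t , ≡.refl = excess-zero t (ℕ.+-cancelʳ-≡ (M ℕ.* b) (i ℕ.+ M ℕ.* t) a (≡.trans (regroup i M b t) eq))
  where
  regroup : ∀ i M b t → i ℕ.+ M ℕ.* t ℕ.+ M ℕ.* b ≡ i ℕ.+ M ℕ.* (b ℕ.+ t)
  regroup = solve-∀
  excess-zero : ∀ s → i ℕ.+ M ℕ.* s ≡ a → i ≡ a × b ℕ.+ s ≡ b
  excess-zero zero p = ≡.trans (≡.sym (ℕ.+-identityʳ i)) (≡.trans (≡.cong (i ℕ.+_) (≡.sym (ℕ.*-zeroʳ M))) p)
                     , ℕ.+-identityʳ b
  excess-zero (suc s) p = ⊥-elim (ℕ.<⇒≱ a<M (≡.subst (M ℕ.≤_) p
    (ℕ.≤-trans (ℕ.m≤m+n M (M ℕ.* s)) (≡.subst (ℕ._≤ i ℕ.+ M ℕ.* suc s) (ℕ.*-suc M s) (ℕ.m≤n+m _ i)))))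

module Kronecker {c ℓ} (R : CommutativeRing c ℓ) where
  open PowerSeries R
  open MultiIndex
  open FiniteSums R
  open SeriesAlgebra R
  open Monomials R
  open Order R
  open Evaluation R
  open SetoidReasoning setoid

  -- Exponent vector d has degree `weightedSum ws d` after substituting X_i ↦ τ^(1 + ws_i).
  weightedSum : ∀ {n} → Vec ℕ n → Vec ℕ n → ℕ
  weightedSum [] [] = 0
  weightedSum (w ∷ ws) (d ∷ ds) = suc w ℕ.* d ℕ.+ weightedSum ws ds

  τ-powers : ∀ {n} → Vec ℕ n → Vec (Series 1) n
  τ-powers = map (λ w → τ ^ˢ suc w)

  Ord≥1-τ-powers : ∀ {n} (ws : Vec ℕ n) → All (Ord≥ 1) (τ-powers ws)
  Ord≥1-τ-powers [] = []
  Ord≥1-τ-powers (w ∷ ws) = Ord≥1-^suc Ord≥1-τ w ∷ Ord≥1-τ-powers ws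

  τ-powers-^ᵛ : ∀ {n} (ws d : Vec ℕ n) → (τ-powers ws ^ᵛ d) ≋ monomial (weightedSum ws d ∷ [])
  τ-powers-^ᵛ [] [] = 𝟙≋monomial
  τ-powers-^ᵛ (w ∷ ws) (d ∷ ds) = ≋.trans
    (⋆-cong (≋.trans (^-* τ (suc w) d) (τ^≋monomial (suc w ℕ.* d))) (τ-powers-^ᵛ ws ds))
    (monomial-⋆ (suc w ℕ.* d ∷ []) (weightedSum ws ds ∷ []))

  sum≤weightedSum : ∀ {n} (ws d : Vec ℕ n) → sum d ≤ weightedSum ws d
  sum≤weightedSum [] [] = z≤n
  sum≤weightedSum (w ∷ ws) (d ∷ ds) = ℕ.+-mono-≤ (ℕ.m≤n*m d (suc w)) (sum≤weightedSum ws ds)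

  -- Compare the coefficients of τ^N, N the weighted sum of u: only the exponents
  -- of weighted sum N contribute to them.
  coefficient-from-τ-powers : ∀ {n} (ws : Vec ℕ n) (D E : Series n) →
    eval D (τ-powers ws) ≋ eval E (τ-powers ws) →
    ∀ u → (∀ d → d ≢ u → weightedSum ws d ≡ weightedSum ws u → D d ≈ E d) → D u ≈ E u
  coefficient-from-τ-powers {n} ws D E D≋E u others = begin
    D u                     ≈⟨ *-identityʳ _ ⟨
    D u * 1#                ≈⟨ *-congˡ (trans (τ-powers-^ᵛ ws u N) (monomial-≡ _ N ≡.refl)) ⟨
    D u * (hs ^ᵛ u) N       ≈⟨ sumBox-cancel (replicate n (sum N)) u (term D) (term E)
                                 (sum≤n⇒≤ᵥreplicate u _ (ℕ.≤-trans (sum≤weightedSum ws u) (ℕ.m≤m+n _ 0)))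
                                 (D≋E N) other-terms ⟩
    E u * (hs ^ᵛ u) N       ≈⟨ *-congˡ (trans (τ-powers-^ᵛ ws u N) (monomial-≡ _ N ≡.refl)) ⟩
    E u * 1#                ≈⟨ *-identityʳ _ ⟩
    E u                     ∎
    where
    hs = τ-powers ws
    N = weightedSum ws u ∷ []
    term : Series n → Vec ℕ n → Carrier
    term G d = G d * (hs ^ᵛ d) N
    other-terms : ∀ d → d ≤ᵥ replicate n (sum N) → d ≢ u → term D d ≈ term E d
    other-terms d _ d≢u with weightedSum ws d ℕ.≟ weightedSum ws u
    ... | yes same = *-congʳ (others d d≢u same)
    ... | no differ = *-cong-≈0ʳ _ _ (trans (τ-powers-^ᵛ ws d N) (monomial-≢ _ N (λ q → differ (≡.sym (Vec.∷-injectiveˡ q)))))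

  weightedSum₂ : ∀ m i j → weightedSum (0 ∷ m ∷ []) (i ∷ j ∷ []) ≡ i ℕ.+ suc m ℕ.* j
  weightedSum₂ = normalize
    where
    normalize : ∀ m i j → 1 ℕ.* i ℕ.+ (suc m ℕ.* j ℕ.+ 0) ≡ i ℕ.+ suc m ℕ.* j
    normalize = solve-∀

  weightedSum₃ : ∀ m q i j k →
    weightedSum (0 ∷ m ∷ q ∷ []) (i ∷ j ∷ k ∷ []) ≡ (i ℕ.+ suc m ℕ.* j) ℕ.+ suc q ℕ.* k
  weightedSum₃ = normalize
    where
    normalize : ∀ m q i j k → 1 ℕ.* i ℕ.+ (suc m ℕ.* j ℕ.+ (suc q ℕ.* k ℕ.+ 0)) ≡ (i ℕ.+ suc m ℕ.* j) ℕ.+ suc q ℕ.* k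
    normalize = solve-∀

  -- Induction on the exponent of Y, with Y ↦ τ^(a+1) for the target exponent a of X.
  kronecker₂ : ∀ (D E : Series 2) →
    (∀ m → eval D (τ-powers (0 ∷ m ∷ [])) ≋ eval E (τ-powers (0 ∷ m ∷ []))) → D ≋ E
  kronecker₂ D E D≋E (a ∷ b ∷ []) = <-rec (λ b → ∀ a → D (a ∷ b ∷ []) ≈ E (a ∷ b ∷ [])) step b a
    where
    step : ∀ b → (∀ {b′} → b′ < b → ∀ a → D (a ∷ b′ ∷ []) ≈ E (a ∷ b′ ∷ [])) → ∀ a → D (a ∷ b ∷ []) ≈ E (a ∷ b ∷ [])
    step b IH a = coefficient-from-τ-powers (0 ∷ a ∷ []) D E (D≋E a) (a ∷ b ∷ []) others
      where
      others : ∀ d → d ≢ a ∷ b ∷ [] → weightedSum (0 ∷ a ∷ []) d ≡ weightedSum (0 ∷ a ∷ []) (a ∷ b ∷ []) → D d ≈ E d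
      others (i ∷ j ∷ []) d≢ same with j ℕ.<? b
      ... | yes j<b = IH j<b i
      ... | no j≮b with digits-unique {suc a} {a} {b} {i} {j} ℕ.≤-refl
                          (≡.trans (≡.sym (weightedSum₂ a i j)) (≡.trans same (weightedSum₂ a a b))) (ℕ.≮⇒≥ j≮b)
      ...   | ≡.refl , ≡.refl = ⊥-elim (d≢ ≡.refl)

  -- Lexicographic induction on the exponents of Z and Y, with Y ↦ τ^(a+1) and
  -- Z ↦ τ^(A+1) where A = a + (a+1) b is the weighted degree of the target X^a Y^b.
  kronecker₃ : ∀ (D E : Series 3) →
    (∀ m q → eval D (τ-powers (0 ∷ m ∷ q ∷ [])) ≋ eval E (τ-powers (0 ∷ m ∷ q ∷ []))) → D ≋ E
  kronecker₃ D E D≋E (a ∷ b ∷ c′ ∷ []) = <-rec (λ c′ → ∀ b a → P a b c′) outer c′ b a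
    where
    P : ℕ → ℕ → ℕ → Set ℓ
    P a b c′ = D (a ∷ b ∷ c′ ∷ []) ≈ E (a ∷ b ∷ c′ ∷ [])
    outer : ∀ c′ → (∀ {c″} → c″ < c′ → ∀ b a → P a b c″) → ∀ b a → P a b c′
    outer c′ IHc = <-rec (λ b → ∀ a → P a b c′) inner
      where
      inner : ∀ b → (∀ {b′} → b′ < b → ∀ a → P a b′ c′) → ∀ a → P a b c′
      inner b IHb a = coefficient-from-τ-powers ws D E (D≋E a A) (a ∷ b ∷ c′ ∷ []) others
        where
        A = a ℕ.+ suc a ℕ.* b
        ws = 0 ∷ a ∷ A ∷ []
        others : ∀ d → d ≢ a ∷ b ∷ c′ ∷ [] → weightedSum ws d ≡ weightedSum ws (a ∷ b ∷ c′ ∷ []) → D d ≈ E d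
        others (i ∷ j ∷ k ∷ []) d≢ same with k ℕ.<? c′
        ... | yes k<c = IHc k<c j i
        ... | no k≮c with digits-unique {suc A} {A} {c′} {i ℕ.+ suc a ℕ.* j} {k} ℕ.≤-refl
                            (≡.trans (≡.sym (weightedSum₃ a A i j k)) (≡.trans same (weightedSum₃ a A a b c′))) (ℕ.≮⇒≥ k≮c)
        ...   | same₂ , ≡.refl with j ℕ.<? b
        ...     | yes j<b = IHb j<b i
        ...     | no j≮b with digits-unique {suc a} {a} {b} {i} {j} ℕ.≤-refl same₂ (ℕ.≮⇒≥ j≮b)
        ...       | ≡.refl , ≡.refl = ⊥-elim (d≢ ≡.refl)

module EvaluationAtVariables {c ℓ} (R : CommutativeRing c ℓ) where
  open PowerSeries R
  open MultiIndex
  open FiniteSums R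
  open SeriesAlgebra R
  open Monomials R
  open Evaluation R
  open SetoidReasoning setoid

  eval-permuting-monomials : ∀ {n} (σ : Vec ℕ n → Vec ℕ n) → (∀ d → σ (σ d) ≡ d) → (∀ d → sum (σ d) ≡ sum d) →
    (hs : Vec (Series n) n) → (∀ d → (hs ^ᵛ d) ≋ monomial (σ d)) → ∀ G e → eval G hs (σ e) ≈ G e
  eval-permuting-monomials {n} σ σσ≡id sum-σ hs hs^≋ G e = begin
    sumBox V (λ d → G d * (hs ^ᵛ d) (σ e)) ≈⟨ sumBox-cong V (λ d _ → *-congˡ (hs^≋ d (σ e))) ⟩
    sumBox V (λ d → G d * monomial (σ d) (σ e))
      ≈⟨ sumBox-single V e (sum≤n⇒≤ᵥreplicate e _ (ℕ.≤-reflexive (≡.sym (sum-σ e))))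
           (λ d _ d≢e → trans (*-congˡ (monomial-≢ (σ d) (σ e) (λ σe≡σd → d≢e (σ-injective σe≡σd)))) (zeroʳ _)) ⟩
    G e * monomial (σ e) (σ e) ≈⟨ *-congˡ (monomial-≡ (σ e) (σ e) ≡.refl) ⟩
    G e * 1#                   ≈⟨ *-identityʳ _ ⟩
    G e                        ∎
    where
    V = replicate n (sum (σ e))
    σ-injective : ∀ {d} → σ e ≡ σ d → d ≡ e
    σ-injective {d} eq = ≡.trans (≡.sym (σσ≡id d)) (≡.trans (≡.cong σ (≡.sym eq)) (σσ≡id e))

  swap : Vec ℕ 2 → Vec ℕ 2
  swap (a ∷ b ∷ []) = b ∷ a ∷ []

  eval-X′Y′ : ∀ G → eval G (X' ∷ Y' ∷ []) ≋ G
  eval-X′Y′ = eval-permuting-monomials (λ d → d) (λ _ → ≡.refl) (λ _ → ≡.refl) (X' ∷ Y' ∷ []) X′Y′^ᵛ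
    where
    X′Y′^ᵛ : ∀ d → ((X' ∷ Y' ∷ []) ^ᵛ d) ≋ monomial d
    X′Y′^ᵛ (i ∷ j ∷ []) = ≋.trans (⋆-cong (X′^≋monomial i) (≋.trans (⋆-identityʳ _) (Y′^≋monomial j)))
      (≋.trans (monomial-⋆ (i ∷ 0 ∷ []) (0 ∷ j ∷ [])) (monomial-cong (≡.cong (_∷ j ∷ []) (ℕ.+-identityʳ i))))

  eval-Y′X′ : ∀ G e → eval G (Y' ∷ X' ∷ []) (swap e) ≈ G e
  eval-Y′X′ = eval-permuting-monomials swap swap-involutive sum-swap (Y' ∷ X' ∷ []) Y′X′^ᵛ
    where
    swap-involutive : ∀ d → swap (swap d) ≡ d
    swap-involutive (a ∷ b ∷ []) = ≡.refl
    sum-swap : ∀ d → sum (swap d) ≡ sum d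
    sum-swap (a ∷ b ∷ []) rewrite ℕ.+-identityʳ a | ℕ.+-identityʳ b = ℕ.+-comm b a
    Y′X′^ᵛ : ∀ d → ((Y' ∷ X' ∷ []) ^ᵛ d) ≋ monomial (swap d)
    Y′X′^ᵛ (i ∷ j ∷ []) = ≋.trans (⋆-cong (Y′^≋monomial i) (≋.trans (⋆-identityʳ _) (X′^≋monomial j)))
      (≋.trans (monomial-⋆ (0 ∷ i ∷ []) (j ∷ 0 ∷ [])) (monomial-cong (≡.cong (λ x → j ∷ x ∷ []) (ℕ.+-identityʳ i))))

  eval-τ𝟘 : ∀ G n → eval G (τ ∷ 𝟘 ∷ []) (n ∷ []) ≈ G (n ∷ 0 ∷ [])
  eval-τ𝟘 G n = begin
    sumBox (replicate 2 (n ℕ.+ 0)) (λ d → G d * (hs ^ᵛ d) (n ∷ []))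
      ≈⟨ sumBox-single (replicate 2 (n ℕ.+ 0)) (n ∷ 0 ∷ []) {λ d → G d * (hs ^ᵛ d) (n ∷ [])} (ℕ.m≤m+n n 0 , z≤n , _)
           (λ d _ d≢ → trans (*-congˡ (other d d≢)) (zeroʳ _)) ⟩
    G (n ∷ 0 ∷ []) * (hs ^ᵛ (n ∷ 0 ∷ [])) (n ∷ []) ≈⟨ *-congˡ (trans (hs^ᵛ-0 n (n ∷ [])) (monomial-≡ (n ∷ []) (n ∷ []) ≡.refl)) ⟩
    G (n ∷ 0 ∷ []) * 1#                            ≈⟨ *-identityʳ _ ⟩
    G (n ∷ 0 ∷ [])                                 ∎
    where
    hs = τ ∷ 𝟘 ∷ []
    hs^ᵛ-0 : ∀ i → (hs ^ᵛ (i ∷ 0 ∷ [])) ≋ monomial (i ∷ [])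
    hs^ᵛ-0 i = ≋.trans (⋆-congˡ (τ ^ˢ i) (⋆-identityˡ 𝟙)) (≋.trans (⋆-identityʳ _) (τ^≋monomial i))
    hs^ᵛ-suc : ∀ i j → (hs ^ᵛ (i ∷ suc j ∷ [])) ≋ 𝟘
    hs^ᵛ-suc i j = ≋.trans (⋆-congˡ (τ ^ˢ i) (≋.trans (⋆-congʳ 𝟙 (⋆-zeroˡ (𝟘 ^ˢ j))) (⋆-zeroˡ 𝟙)))
                           (≋.trans (⋆-comm (τ ^ˢ i) 𝟘) (⋆-zeroˡ (τ ^ˢ i)))
    other : ∀ d → d ≢ n ∷ 0 ∷ [] → (hs ^ᵛ d) (n ∷ []) ≈ 0#
    other (i ∷ zero ∷ []) d≢ = trans (hs^ᵛ-0 i (n ∷ []))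
      (monomial-≢ _ _ (λ n≡i → d≢ (≡.cong (λ x → x ∷ 0 ∷ []) (≡.sym (Vec.∷-injectiveˡ n≡i)))))
    other (i ∷ suc j ∷ []) _ = hs^ᵛ-suc i j (n ∷ [])

module FormalGroupLaw {c ℓ} (R : CommutativeRing c ℓ) (F : PowerSeries.Series R 2)
    (F00 : CommutativeRing._≈_ R (F (0 ∷ 0 ∷ [])) (CommutativeRing.0# R)) where
  open PowerSeries R
  open MultiIndex
  open FiniteSums R
  open SeriesAlgebra R
  open Monomials R
  open Order R
  open Evaluation R
  open EvaluationAtVariables R
  open Kronecker R
  module ≈-Reasoning = SetoidReasoning setoid
  module ≋-Reasoning = SetoidReasoning (≋-setoid 1)

  _⊕_ : τSeries → τSeries → τSeries
  _⊕_ = ⊕[ F , F00 ]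

  subst≋eval : ∀ {k} (f g : Series k) → subst F f g ≋ eval F (f ∷ g ∷ [])
  subst≋eval f g e = sumTo-cong (sum e) (λ i _ → sumTo-cong (sum e) (λ j _ →
    *-congˡ (⋆-congˡ (f ^ˢ i) (≋.sym (⋆-identityʳ (g ^ˢ j))) e)))

  subst-cong : ∀ {k} {f f′ g g′ : Series k} → f ≋ f′ → g ≋ g′ → subst F f g ≋ subst F f′ g′
  subst-cong {f = f} {f′} {g} {g′} f≋f′ g≋g′ = ≋.trans (subst≋eval f g)
    (≋.trans (eval-congʳ F (f≋f′ ∷ g≋g′ ∷ [])) (≋.sym (subst≋eval f′ g′)))

  Ord≥1-subst : ∀ {k} (f g : Series k) → Ord≥ 1 (subst F f g)
  Ord≥1-subst f g = Ord≥-cong 1 (≋.sym (subst≋eval f g)) (Ord≥1-eval (f ∷ g ∷ []) (const≈0⇒Ord≥1 F F00))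

  eval-subst : ∀ {n k} {A B : Series n} {hs : Vec (Series k) n} {a b : Series k} →
    Ord≥ 1 A → Ord≥ 1 B → All (Ord≥ 1) hs → eval A hs ≋ a → eval B hs ≋ b → eval (subst F A B) hs ≋ subst F a b
  eval-subst {A = A} {B} {hs} oA oB os A[hs]≋a B[hs]≋b = ≋.trans (eval-congˡ (subst≋eval A B) hs)
    (≋.trans (eval-eval F (oA ∷ oB ∷ []) os)
    (≋.trans (≋.sym (subst≋eval (eval A hs) (eval B hs))) (subst-cong A[hs]≋a B[hs]≋b)))

  Ord≥1-τSeries : (f : τSeries) → Ord≥ 1 (proj₁ f)
  Ord≥1-τSeries (f , f0≈0) = const≈0⇒Ord≥1 f f0≈0

  module Inverse (F01≈1 : F (0 ∷ 1 ∷ []) ≈ 1#) where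
    open import Algebra.Properties.Group +-group using (x∙y⁻¹≈ε⇒x≈y; x≈y⇒x∙y⁻¹≈ε; ⁻¹-involutive; ε⁻¹≈ε; identityʳ-unique)
    open ≈-Reasoning
    open import Tactic.RingSolver.NonReflective (fromCommutativeRing R (λ _ → nothing)) using (solve; _⊜_; ⊝_) renaming (_⊕_ to _⊞_)

    -- The fixed points of `improve` are the g with F(τ, g) = 0.  As F(τ, g) is g
    -- plus terms free of g plus terms τ^i g^j with j ≥ 1 and i + j ≥ 2, `improve`
    -- is a contraction: one more coefficient stabilises at every step.
    improve : Series 1 → Series 1
    improve g e = g e - subst F τ g e

    Ord≥1-improve : ∀ {g} → Ord≥ 1 g → Ord≥ 1 (improve g)
    Ord≥1-improve og e lt = trans (+-cong (og e lt) (-‿cong (Ord≥1-subst τ _ e lt))) (-‿inverseʳ 0#)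

    τ^⋆g^ : Series 1 → Vec ℕ 2 → Series 1
    τ^⋆g^ g (i ∷ j ∷ []) = (τ ^ˢ i) ⋆ (g ^ˢ j)

    τ^⋆g^-≋[<] : ∀ {n} {g g′ : Series 1} → Ord≥ 1 g → Ord≥ 1 g′ → g ≋[< n ] g′ →
      ∀ d → d ≢ 0 ∷ 1 ∷ [] → τ^⋆g^ g d ≋[< suc n ] τ^⋆g^ g′ d
    τ^⋆g^-≋[<] {g = g} {g′} og og′ p (suc i ∷ j ∷ []) _ = ≋[<]-trans (≋⇒≋[<] (⋆-assoc τ (τ ^ˢ i) (g ^ˢ j)))
      (≋[<]-trans (≋[<]-Ord≥1⋆ Ord≥1-τ (≋[<]-⋆ (≋[<]-refl {f = τ ^ˢ i}) (≋[<]-^ p j)))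
      (≋⇒≋[<] (≋.sym (⋆-assoc τ (τ ^ˢ i) (g′ ^ˢ j)))))
    τ^⋆g^-≋[<] og og′ p (zero ∷ zero ∷ []) _ = ≋[<]-refl
    τ^⋆g^-≋[<] og og′ p (zero ∷ suc zero ∷ []) d≢ = ⊥-elim (d≢ ≡.refl)
    τ^⋆g^-≋[<] {g = g} {g′} og og′ p (zero ∷ suc (suc j) ∷ []) _ = ≋[<]-⋆ (≋[<]-refl {f = 𝟙})
      (≋[<]-trans (≋⇒≋[<] (⋆-comm g gʲ)) (≋[<]-trans (≋[<]-Ord≥1⋆ (Ord≥1-^suc og j) p)
      (≋[<]-trans (≋⇒≋[<] (⋆-comm gʲ g′)) (≋[<]-Ord≥1⋆ og′ (≋[<]-^ p (suc j))))))
      where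
      gʲ = g ^ˢ suc j

    improve-contracts : ∀ {n} {g g′ : Series 1} → Ord≥ 1 g → Ord≥ 1 g′ → g ≋[< n ] g′ → improve g ≋[< suc n ] improve g′
    improve-contracts {n} {g} {g′} og og′ p e lt with sum e ℕ.<? 1
    ... | yes e<1 = trans (Ord≥1-improve og e e<1) (sym (Ord≥1-improve og′ e e<1))
    ... | no e≮1 = x∙y⁻¹≈ε⇒x≈y _ _ (begin
      (g e - S g) - (g′ e - S g′)   ≈⟨ regroup (g e) (g′ e) (S g) (S g′) ⟩
      (g e - g′ e) - (S g - S g′)   ≈⟨ x≈y⇒x∙y⁻¹≈ε (sym S-difference) ⟩
      0#                            ∎)
      where
      V = replicate 2 (sum e)
      S : Series 1 → Carrier
      S h = sumBox V (λ d → F d * τ^⋆g^ h d e)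
      term : Series 1 → Vec ℕ 2 → Carrier
      term h d = F d * τ^⋆g^ h d e
      linear-term : ∀ h → term h (0 ∷ 1 ∷ []) ≈ h e
      linear-term h = trans (*-cong F01≈1 (≋.trans (⋆-identityˡ _) (⋆-identityʳ h) e)) (*-identityˡ _)
      S-difference : S g - S g′ ≈ g e - g′ e
      S-difference = begin
        S g - S g′                          ≈⟨ sumBox-difference V (term g) (term g′) ⟨
        sumBox V (λ d → term g d - term g′ d)
          ≈⟨ sumBox-single V (0 ∷ 1 ∷ []) {λ d → term g d - term g′ d} (z≤n , ℕ.≮⇒≥ e≮1 , tt)
               (λ d _ d≢ → x≈y⇒x∙y⁻¹≈ε (*-congˡ (τ^⋆g^-≋[<] og og′ p d d≢ e lt))) ⟩
        term g (0 ∷ 1 ∷ []) - term g′ (0 ∷ 1 ∷ []) ≈⟨ +-cong (linear-term g) (-‿cong (linear-term g′)) ⟩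
        g e - g′ e                          ∎
      regroup : ∀ x x′ s s′ → (x - s) - (x′ - s′) ≈ (x - x′) - (s - s′)
      regroup = solve 4 (λ x x′ s s′ → ((x ⊞ (⊝ s)) ⊞ (⊝ (x′ ⊞ (⊝ s′)))) ⊜ ((x ⊞ (⊝ x′)) ⊞ (⊝ (s ⊞ (⊝ s′))))) refl

    iterate : ℕ → Series 1
    iterate zero = 𝟘
    iterate (suc k) = improve (iterate k)

    Ord≥1-iterate : ∀ k → Ord≥ 1 (iterate k)
    Ord≥1-iterate zero e _ = refl
    Ord≥1-iterate (suc k) = Ord≥1-improve (Ord≥1-iterate k)

    iterate-step : ∀ k → iterate k ≋[< k ] iterate (suc k)
    iterate-step zero e ()
    iterate-step (suc k) = improve-contracts (Ord≥1-iterate k) (Ord≥1-iterate (suc k)) (iterate-step k)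

    iterate-stable : ∀ k m → k ≤ m → iterate k ≋[< k ] iterate m
    iterate-stable k zero z≤n = ≋[<]-refl
    iterate-stable k (suc m) k≤1+m with ℕ.m≤n⇒m<n∨m≡n k≤1+m
    ... | inj₂ ≡.refl = ≋[<]-refl
    ... | inj₁ (s≤s k≤m) = ≋[<]-trans (iterate-stable k m k≤m) (≋[<]-weaken k≤m (iterate-step m))

    -- The coefficient of τ^m is constant from the (m+1)-st iterate on.
    ι : Series 1
    ι (m ∷ []) = iterate (suc m) (m ∷ [])

    ι-≋[<]-iterate : ∀ n → ι ≋[< n ] iterate n
    ι-≋[<]-iterate n (m ∷ []) m+0<n =
      iterate-stable (suc m) n (≡.subst (_< n) (ℕ.+-identityʳ m) m+0<n) (m ∷ []) (s≤s (ℕ.≤-reflexive (ℕ.+-identityʳ m)))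

    Ord≥1-ι : Ord≥ 1 ι
    Ord≥1-ι = const≈0⇒Ord≥1 ι (Ord≥1-iterate 1 (0 ∷ []) (s≤s z≤n))

    subst-τ-ι≋𝟘 : subst F τ ι ≋ 𝟘
    subst-τ-ι≋𝟘 (m ∷ []) = begin
      subst F τ ι (m ∷ [])           ≈⟨ ⁻¹-involutive _ ⟨
      - - subst F τ ι (m ∷ [])       ≈⟨ -‿cong (identityʳ-unique (ι (m ∷ [])) _ ι-fixed) ⟩
      - 0#                           ≈⟨ ε⁻¹≈ε ⟩
      0#                             ∎
      where
      ι-fixed : improve ι (m ∷ []) ≈ ι (m ∷ [])
      ι-fixed = improve-contracts Ord≥1-ι (Ord≥1-iterate m) (ι-≋[<]-iterate m) (m ∷ [])
                  (s≤s (ℕ.≤-reflexive (ℕ.+-identityʳ m)))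

  ≈τ-isEquivalence : IsEquivalence _≈τ_
  ≈τ-isEquivalence = On.isEquivalence proj₁ ≋-isEquivalence

  ⊕-cong : ∀ {f f′ g g′} → f ≈τ f′ → g ≈τ g′ → (f ⊕ g) ≈τ (f′ ⊕ g′)
  ⊕-cong = subst-cong

  module FromCond1 (cond1 : Cond1 F) where
    F[X,0]≋X : subst F τ 𝟘 ≋ τ
    F[X,0]≋X = proj₁ cond1

    F-comm : subst F X' Y' ≋ subst F Y' X'
    F-comm = proj₁ (proj₂ cond1)

    F-assoc : subst F (subst F X Y) Z ≋ subst F X (subst F Y Z)
    F-assoc = proj₂ (proj₂ cond1)

    F10≈1 : F (1 ∷ 0 ∷ []) ≈ 1#
    F10≈1 = begin
      F (1 ∷ 0 ∷ [])                 ≈⟨ eval-τ𝟘 F 1 ⟨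
      eval F (τ ∷ 𝟘 ∷ []) (1 ∷ [])   ≈⟨ subst≋eval τ 𝟘 (1 ∷ []) ⟨
      subst F τ 𝟘 (1 ∷ [])           ≈⟨ F[X,0]≋X (1 ∷ []) ⟩
      τ (1 ∷ [])                     ≈⟨ var-unit {1} zero ⟩
      1#                             ∎
      where open ≈-Reasoning

    F01≈1 : F (0 ∷ 1 ∷ []) ≈ 1#
    F01≈1 = begin
      F (0 ∷ 1 ∷ [])                         ≈⟨ eval-Y′X′ F (0 ∷ 1 ∷ []) ⟨
      eval F (Y' ∷ X' ∷ []) (1 ∷ 0 ∷ [])     ≈⟨ subst≋eval Y' X' (1 ∷ 0 ∷ []) ⟨
      subst F Y' X' (1 ∷ 0 ∷ [])             ≈⟨ F-comm (1 ∷ 0 ∷ []) ⟨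
      subst F X' Y' (1 ∷ 0 ∷ [])             ≈⟨ subst≋eval X' Y' (1 ∷ 0 ∷ []) ⟩
      eval F (X' ∷ Y' ∷ []) (1 ∷ 0 ∷ [])     ≈⟨ eval-X′Y′ F (1 ∷ 0 ∷ []) ⟩
      F (1 ∷ 0 ∷ [])                         ≈⟨ F10≈1 ⟩
      1#                                     ∎
      where open ≈-Reasoning

    open Inverse F01≈1

    ⊖_ : τSeries → τSeries
    ⊖ (f , _) = eval ι (f ∷ []) , Ord≥1⇒const≈0 _ (Ord≥1-eval (f ∷ []) Ord≥1-ι)

    ⊕-identityʳ : ∀ f → (f ⊕ 0τ) ≈τ f
    ⊕-identityʳ f@(f₁ , _) = begin
      subst F f₁ 𝟘              ≈⟨ eval-subst Ord≥1-τ (λ _ _ → refl) os (eval-var zero os) (eval-𝟘 (f₁ ∷ [])) ⟨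
      eval (subst F τ 𝟘) (f₁ ∷ []) ≈⟨ eval-congˡ F[X,0]≋X (f₁ ∷ []) ⟩
      eval τ (f₁ ∷ [])          ≈⟨ eval-var zero os ⟩
      f₁                        ∎
      where
      open ≋-Reasoning
      os = Ord≥1-τSeries f ∷ []

    ⊕-comm : ∀ f g → (f ⊕ g) ≈τ (g ⊕ f)
    ⊕-comm f@(f₁ , _) g@(g₁ , _) = begin
      subst F f₁ g₁        ≈⟨ eval-subst (Ord≥1-var zero) (Ord≥1-var (suc zero)) os x y ⟨
      eval (subst F X' Y') hs ≈⟨ eval-congˡ F-comm hs ⟩
      eval (subst F Y' X') hs ≈⟨ eval-subst (Ord≥1-var (suc zero)) (Ord≥1-var zero) os y x ⟩
      subst F g₁ f₁        ∎
      where
      open ≋-Reasoning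
      hs = f₁ ∷ g₁ ∷ []
      os = Ord≥1-τSeries f ∷ Ord≥1-τSeries g ∷ []
      x = eval-var zero os
      y = eval-var (suc zero) os

    ⊕-assoc : ∀ f g h → ((f ⊕ g) ⊕ h) ≈τ (f ⊕ (g ⊕ h))
    ⊕-assoc f@(f₁ , _) g@(g₁ , _) h@(h₁ , _) = begin
      subst F (subst F f₁ g₁) h₁      ≈⟨ eval-subst (Ord≥1-subst X Y) (Ord≥1-var (suc (suc zero))) os
                                           (eval-subst (Ord≥1-var zero) (Ord≥1-var (suc zero)) os x y) z ⟨
      eval (subst F (subst F X Y) Z) hs ≈⟨ eval-congˡ F-assoc hs ⟩
      eval (subst F X (subst F Y Z)) hs ≈⟨ eval-subst (Ord≥1-var zero) (Ord≥1-subst Y Z) os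
                                           x (eval-subst (Ord≥1-var (suc zero)) (Ord≥1-var (suc (suc zero))) os y z) ⟩
      subst F f₁ (subst F g₁ h₁)      ∎
      where
      open ≋-Reasoning
      hs = f₁ ∷ g₁ ∷ h₁ ∷ []
      os = Ord≥1-τSeries f ∷ Ord≥1-τSeries g ∷ Ord≥1-τSeries h ∷ []
      x = eval-var zero os
      y = eval-var (suc zero) os
      z = eval-var (suc (suc zero)) os

    ⊕-inverseʳ : ∀ f → (f ⊕ (⊖ f)) ≈τ 0τ
    ⊕-inverseʳ f@(f₁ , _) = begin
      subst F f₁ (eval ι hs)   ≈⟨ eval-subst Ord≥1-τ Ord≥1-ι os (eval-var zero os) ≋.refl ⟨
      eval (subst F τ ι) hs    ≈⟨ eval-congˡ subst-τ-ι≋𝟘 hs ⟩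
      eval 𝟘 hs                ≈⟨ eval-𝟘 hs ⟩
      𝟘                        ∎
      where
      open ≋-Reasoning
      hs = f₁ ∷ []
      os = Ord≥1-τSeries f ∷ []

    cond2 : Cond2 F F00
    cond2 = ⊖_ , record
      { isGroup = record
        { isMonoid = record
          { isSemigroup = record
            { isMagma = record { isEquivalence = ≈τ-isEquivalence ; ∙-cong = λ {f} {f′} {g} {g′} → ⊕-cong {f} {f′} {g} {g′} }
            ; assoc = ⊕-assoc }
          ; identity = (λ f → ≋.trans (⊕-comm 0τ f) (⊕-identityʳ f)) , ⊕-identityʳ }
        ; inverse = (λ f → ≋.trans (⊕-comm (⊖ f) f) (⊕-inverseʳ f)) , ⊕-inverseʳ
        ; ⁻¹-cong = λ f≈g → eval-congʳ ι (f≈g ∷ []) }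
      ; comm = ⊕-comm }

  module FromCond3 (cond3 : Cond3 F F00) where
    open IsCommutativeMonoid cond3 using (identityʳ; comm; assoc)

    τ^suc : ℕ → τSeries
    τ^suc w = τ ^ˢ suc w , Ord≥1⇒const≈0 _ (Ord≥1-^suc Ord≥1-τ w)

    F[X,0]≋X : subst F τ 𝟘 ≋ τ
    F[X,0]≋X = identityʳ (τ , Ord≥1⇒const≈0 τ Ord≥1-τ)

    F-comm : subst F X' Y' ≋ subst F Y' X'
    F-comm = kronecker₂ _ _ λ m →
      let ws = 0 ∷ m ∷ []
          os = Ord≥1-τ-powers ws
          x = eval-var zero os
          y = eval-var (suc zero) os
          open ≋-Reasoning
      in begin
      eval (subst F X' Y') (τ-powers ws) ≈⟨ eval-subst (Ord≥1-var zero) (Ord≥1-var (suc zero)) os x y ⟩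
      subst F (τ ^ˢ 1) (τ ^ˢ suc m)      ≈⟨ comm (τ^suc 0) (τ^suc m) ⟩
      subst F (τ ^ˢ suc m) (τ ^ˢ 1)      ≈⟨ eval-subst (Ord≥1-var (suc zero)) (Ord≥1-var zero) os y x ⟨
      eval (subst F Y' X') (τ-powers ws) ∎

    F-assoc : subst F (subst F X Y) Z ≋ subst F X (subst F Y Z)
    F-assoc = kronecker₃ _ _ λ m q →
      let ws = 0 ∷ m ∷ q ∷ []
          os = Ord≥1-τ-powers ws
          x = eval-var zero os
          y = eval-var (suc zero) os
          z = eval-var (suc (suc zero)) os
          open ≋-Reasoning
      in begin
      eval (subst F (subst F X Y) Z) (τ-powers ws)
        ≈⟨ eval-subst (Ord≥1-subst X Y) (Ord≥1-var (suc (suc zero))) os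
             (eval-subst (Ord≥1-var zero) (Ord≥1-var (suc zero)) os x y) z ⟩
      subst F (subst F (τ ^ˢ 1) (τ ^ˢ suc m)) (τ ^ˢ suc q)
        ≈⟨ assoc (τ^suc 0) (τ^suc m) (τ^suc q) ⟩
      subst F (τ ^ˢ 1) (subst F (τ ^ˢ suc m) (τ ^ˢ suc q))
        ≈⟨ eval-subst (Ord≥1-var zero) (Ord≥1-subst Y Z) os
             x (eval-subst (Ord≥1-var (suc zero)) (Ord≥1-var (suc (suc zero))) os y z) ⟨
      eval (subst F X (subst F Y Z)) (τ-powers ws) ∎

    cond1 : Cond1 F
    cond1 = F[X,0]≋X , F-comm , F-assoc

proposition1p1 : ∀ {c ℓ} (R : CommutativeRing c ℓ) (F : PowerSeries.Series R 2)
    (F00 : CommutativeRing._≈_ R (F (0 ∷ 0 ∷ [])) (CommutativeRing.0# R)) →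
    (PowerSeries.Cond1 R F → PowerSeries.Cond2 R F F00)
    × (PowerSeries.Cond2 R F F00 → PowerSeries.Cond3 R F F00)
    × (PowerSeries.Cond3 R F F00 → PowerSeries.Cond1 R F)
proposition1p1 R F F00 =
    FromCond1.cond2
  , (λ (_ , isAbelianGroup) → IsAbelianGroup.isCommutativeMonoid isAbelianGroup)
  , FromCond3.cond1
  where open FormalGroupLaw R F F00
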